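{- For every integer $n\ge 2$, $$P^{\mathrm{Clr}}_{D_n}(q,1,-1)=(q^2-1)\,P^{\mathrm{Clr}}_{D_{n-1}}(q,1,-1),$$ and hence, for every $n\ge1$, $P^{\mathrm{Clr}}_{D_n}(q,1,-1)=-(q^2-1)^{n-1}$.
   Context: $B_n=G_{2,n}$ is the set of pairs $\sigma=(z,\tau)$ with $z=(z_1,\dots,z_n)\in\{0,1\}^n$, $\tau\in S_n$ (signed permutations), and $D_n=\{\sigma\in B_n:\sum_i z_i\equiv 0 \pmod 2\}$. Statistics: $\mathrm{csum}(\sigma)=\sum_{i=1}^n z_i$ (as integers); $\mathrm{exc}_A(\sigma)=\#\{i\in[n-1]: z_i=0\text{ and }\tau(i)>i\}$; $\mathrm{cyc}(\sigma)$ = number of cycles of $\tau$; $\mathrm{fix}(\sigma)=\#\{i:\tau(i)=i\}$. Define $\mathrm{exc}^{\mathrm{Clr}}(\sigma)=2\,\mathrm{exc}_A(\sigma)+\mathrm{csum}(\sigma)$ and $P^{\mathrm{Clr}}_{D_n}(q,t,s)=\sum_{\sigma\in D_n}q^{\mathrm{exc}^{\mathrm{Clr}}(\sigma)}t^{\mathrm{fix}(\sigma)}s^{\mathrm{cyc}(\sigma)}$. -}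

module Defs where

open import Data.Nat using (ℕ; zero; suc; _≤ᵇ_; _<ᵇ_; _∸_)
import Data.Nat as ℕ
open import Data.Fin using (Fin; toℕ)
open import Data.Fin.Properties using (_≟_)
open import Data.Bool using (Bool; true; false; _∧_; T?)
open import Data.List using (List; []; _∷_; [_]; map; concatMap; filter; foldr; upTo; allFin)
open import Data.Vec using (Vec; lookup; toList)
  renaming ([] to []ᵥ; _∷_ to _∷ᵥ_)
open import Data.Product using (_×_; _,_; proj₁; proj₂)
open import Data.Integer using (ℤ; _+_; _*_; _^_; +_)
open import Relation.Nullary.Decidable using (⌊_⌋)
import Data.List.Relation.Unary.Unique.DecPropositional as UniqueDec

allVecs : {A : Set} → (n : ℕ) → List A → List (Vec A n)
allVecs zero xs = [ []ᵥ ]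
allVecs (suc n) xs = concatMap (λ x → map (x ∷ᵥ_) (allVecs n xs)) xs

-- S_n: permutations τ of [n] (positions 1..n encoded 0-based as Fin n),
-- in one-line notation (τ(1),…,τ(n)) with pairwise distinct entries.
perms : (n : ℕ) → List (Vec (Fin n) n)
perms n = filter (λ v → UniqueDec.unique? _≟_ (toList v)) (allVecs n (allFin n))

colours : (n : ℕ) → List (Vec (Fin 2) n)
colours n = allVecs n (allFin 2)

isEven : ℕ → Bool
isEven zero = true
isEven (suc zero) = false
isEven (suc (suc k)) = isEven k

countB : {A : Set} → (A → Bool) → List A → ℕ
countB p [] = 0
countB p (x ∷ xs) with p x
... | true = suc (countB p xs)
... | false = countB p xs

-- A signed permutation σ = (z, τ) ∈ B_n = G_{2,n}
B : ℕ → Set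
B n = Vec (Fin 2) n × Vec (Fin n) n

csum : {n : ℕ} → B n → ℕ
csum (z , τ) = foldr (λ c acc → toℕ c ℕ.+ acc) 0 (toList z)

Dn : (n : ℕ) → List (B n)
Dn n = filter (λ σ → T? (isEven (csum σ)))
         (concatMap (λ z → map (z ,_) (perms n)) (colours n))

isZero : Fin 2 → Bool
isZero c = toℕ c ℕ.≡ᵇ 0

-- exc_A(σ) = #{ i ∈ [n-1] : z_i = 0 and τ(i) > i }
-- (0-based index i corresponds to 1-based i+1; i+1 ∈ [n-1] iff toℕ i < n ∸ 1)
excA : {n : ℕ} → B n → ℕ
excA {n} (z , τ) =
  countB (λ i → (toℕ i <ᵇ n ∸ 1) ∧ isZero (lookup z i) ∧ (toℕ i <ᵇ toℕ (lookup τ i)))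
         (allFin n)

fix : {n : ℕ} → B n → ℕ
fix {n} (z , τ) = countB (λ i → ⌊ lookup τ i ≟ i ⌋) (allFin n)

iter : {n : ℕ} → Vec (Fin n) n → ℕ → Fin n → Fin n
iter τ zero i = i
iter τ (suc k) i = lookup τ (iter τ k i)

allB : {A : Set} → (A → Bool) → List A → Bool
allB p [] = true
allB p (x ∷ xs) = p x ∧ allB p xs

-- i is the smallest element of its cycle of τ (the cycle of i is
-- {τ^k(i) : 0 ≤ k ≤ n}, since every cycle has length ≤ n)
isCycleMin : {n : ℕ} → Vec (Fin n) n → Fin n → Bool
isCycleMin {n} τ i = allB (λ k → toℕ i ≤ᵇ toℕ (iter τ k i)) (upTo (suc n))

-- cyc(σ) = number of cycles of τ = number of cycle minima
cyc : {n : ℕ} → B n → ℕ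
cyc {n} (z , τ) = countB (isCycleMin τ) (allFin n)

excClr : {n : ℕ} → B n → ℕ
excClr σ = 2 ℕ.* excA σ ℕ.+ csum σ

sumℤ : List ℤ → ℤ
sumℤ = foldr _+_ (+ 0)

PClrD : (n : ℕ) → ℤ → ℤ → ℤ → ℤ
PClrD n q t s = sumℤ (map (λ σ → q ^ excClr σ * t ^ fix σ * s ^ cyc σ) (Dn n))

{-# OPTIONS --safe #-}
module Submission where

-- Fix τ ∈ S_n and sum over the colour vectors z. For y ∈ {q, −q} we have y² = q², so the sum of
-- (q²)^(number of excedances of τ at positions of colour 0) · y^csum(z) factorises over the positions into
-- (1 + y)^n y^exc(τ). Keeping only even csum by averaging y = q and y = −q gives
--   2 P_n(q) = (1 + q)^n E_n(q) + (1 − q)^n E_n(−q),  where E_n(x) = Σ_{τ ∈ S_n} x^exc(τ) (−1)^cyc(τ).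
-- Composing τ with the transposition of the last two points flips the parity of cyc(τ) and changes exc(τ) only
-- at those two points. This involution cancels all permutations except those sending one of the last two points
-- to the last one, and yields E_n(x) = (x − 1) E_{n−1}(x), so E_n(x) = −(x − 1)^(n−1). Hence
-- 2 P_n(q) = −(1 + q)(q² − 1)^(n−1) − (1 − q)(q² − 1)^(n−1) = −2 (q² − 1)^(n−1).

module ListSum where

  open import Data.Bool using (true; false; if_then_else_)
  open import Data.List using (List; []; _∷_; [_]; map; concatMap; filter; _++_; _∷ʳ_)
  open import Data.List.Membership.Propositional using (_∈_)
  open import Data.List.Relation.Unary.Any using (here; there)
  open import Data.Integer using (ℤ; _+_; _*_; +_; -_)
  open import Data.Integer.Properties
  open import Data.Integer.Tactic.RingSolver using (solve-∀)
  open import Relation.Nullary using (does)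
  open import Level using (0ℓ)
  open import Relation.Unary using (Pred; Decidable)
  open import Relation.Binary.PropositionalEquality hiding ([_])
  open import Defs using (sumℤ)

  ∑ : {A : Set} → (A → ℤ) → List A → ℤ
  ∑ f xs = sumℤ (map f xs)

  module _ {A : Set} where

    ∑-++ : (f : A → ℤ) (xs ys : List A) → ∑ f (xs ++ ys) ≡ ∑ f xs + ∑ f ys
    ∑-++ f [] ys = sym (+-identityˡ _)
    ∑-++ f (x ∷ xs) ys = trans (cong (_+_ (f x)) (∑-++ f xs ys)) (sym (+-assoc (f x) _ _))

    ∑-∷ʳ : (f : A → ℤ) (xs : List A) (x : A) → ∑ f (xs ∷ʳ x) ≡ ∑ f xs + f x
    ∑-∷ʳ f xs x = trans (∑-++ f xs [ x ]) (cong (_+_ (∑ f xs)) (+-identityʳ (f x)))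

    ∑-cong : {f g : A → ℤ} (xs : List A) → (∀ x → f x ≡ g x) → ∑ f xs ≡ ∑ g xs
    ∑-cong [] f≗g = refl
    ∑-cong (x ∷ xs) f≗g = cong₂ _+_ (f≗g x) (∑-cong xs f≗g)

    ∑-cong-∈ : {f g : A → ℤ} (xs : List A) → (∀ x → x ∈ xs → f x ≡ g x) → ∑ f xs ≡ ∑ g xs
    ∑-cong-∈ [] f≗g = refl
    ∑-cong-∈ (x ∷ xs) f≗g =
      cong₂ _+_ (f≗g x (here refl)) (∑-cong-∈ xs (λ y y∈xs → f≗g y (there y∈xs)))

    ∑-zero : (xs : List A) → ∑ (λ _ → + 0) xs ≡ + 0
    ∑-zero [] = refl
    ∑-zero (x ∷ xs) = trans (+-identityˡ _) (∑-zero xs)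

    ∑-distrib-+ : (f g : A → ℤ) (xs : List A) → ∑ (λ x → f x + g x) xs ≡ ∑ f xs + ∑ g xs
    ∑-distrib-+ f g [] = refl
    ∑-distrib-+ f g (x ∷ xs) =
      trans (cong (_+_ (f x + g x)) (∑-distrib-+ f g xs)) (interchange (f x) (g x) _ _)
      where
      interchange : ∀ a b c d → (a + b) + (c + d) ≡ (a + c) + (b + d)
      interchange = solve-∀

    ∑-*ˡ : (c : ℤ) (f : A → ℤ) (xs : List A) → ∑ (λ x → c * f x) xs ≡ c * ∑ f xs
    ∑-*ˡ c f [] = sym (*-zeroʳ c)
    ∑-*ˡ c f (x ∷ xs) = trans (cong (_+_ (c * f x)) (∑-*ˡ c f xs)) (sym (*-distribˡ-+ c (f x) _))

    ∑-neg : (f : A → ℤ) (xs : List A) → ∑ (λ x → - f x) xs ≡ - ∑ f xs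
    ∑-neg f [] = refl
    ∑-neg f (x ∷ xs) = trans (cong (_+_ (- f x)) (∑-neg f xs)) (sym (neg-distrib-+ (f x) _))

    ∑-filter : {P : Pred A 0ℓ} (P? : Decidable P) (f : A → ℤ) (xs : List A) →
               ∑ f (filter P? xs) ≡ ∑ (λ x → if does (P? x) then f x else + 0) xs
    ∑-filter P? f [] = refl
    ∑-filter P? f (x ∷ xs) with does (P? x)
    ... | true = cong (_+_ (f x)) (∑-filter P? f xs)
    ... | false = trans (∑-filter P? f xs) (sym (+-identityˡ _))

  ∑-map : {A B : Set} (f : B → ℤ) (h : A → B) (xs : List A) → ∑ f (map h xs) ≡ ∑ (λ x → f (h x)) xs
  ∑-map f h [] = refl
  ∑-map f h (x ∷ xs) = cong (_+_ (f (h x))) (∑-map f h xs)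

  ∑-concatMap : {A B : Set} (f : B → ℤ) (g : A → List B) (xs : List A) →
                ∑ f (concatMap g xs) ≡ ∑ (λ x → ∑ f (g x)) xs
  ∑-concatMap f g [] = refl
  ∑-concatMap f g (x ∷ xs) =
    trans (∑-++ f (g x) (concatMap g xs)) (cong (_+_ (∑ f (g x))) (∑-concatMap f g xs))

  ∑-comm : {A B : Set} (f : A → B → ℤ) (xs : List A) (ys : List B) →
           ∑ (λ x → ∑ (f x) ys) xs ≡ ∑ (λ y → ∑ (λ x → f x y) xs) ys
  ∑-comm f [] ys = sym (∑-zero ys)
  ∑-comm f (x ∷ xs) ys =
    trans (cong (_+_ (∑ (f x) ys)) (∑-comm f xs ys)) (sym (∑-distrib-+ (f x) (λ y → ∑ (λ x → f x y) xs) ys))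

module Booleans where

  open import Data.Nat using (ℕ; zero; suc; _+_; _<_; z<s; s<s)
  open import Data.Nat.Properties using (+-comm; +-assoc)
  open import Data.Bool using (Bool; true; false; T; not; _∧_)
  open import Data.Bool.Properties using (T-∧)
  open import Data.List using ([]; _∷_; applyUpTo)
  open import Data.Product using (_,_; proj₁; proj₂)
  open import Function using (_∘_; Equivalence)
  open import Relation.Nullary using (¬_; Dec; yes; does)
  open import Relation.Nullary.Decidable using (dec-true; dec-false)
  open import Relation.Binary.PropositionalEquality
  open import Defs using (allB)
  open Equivalence using (to; from)

  does≡true⇒ : ∀ {A : Set} (a? : Dec A) → does a? ≡ true → A
  does≡true⇒ (yes a) _ = a

  T-not-does⇒¬ : ∀ {A : Set} (a? : Dec A) → T (not (does a?)) → ¬ A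
  T-not-does⇒¬ a? ¬a? a rewrite dec-true a? a = ¬a?

  ¬⇒T-not-does : ∀ {A : Set} (a? : Dec A) → ¬ A → T (not (does a?))
  ¬⇒T-not-does a? ¬a rewrite dec-false a? ¬a = _

  bit : Bool → ℕ
  bit true = 1
  bit false = 0

  countBelow : (ℕ → Bool) → ℕ → ℕ
  countBelow p zero = 0
  countBelow p (suc n) = bit (p 0) + countBelow (p ∘ suc) n

  countBelow-suc : ∀ p n → countBelow p (suc n) ≡ countBelow p n + bit (p n)
  countBelow-suc p zero = +-comm (bit (p 0)) 0
  countBelow-suc p (suc n) =
    trans (cong (bit (p 0) +_) (countBelow-suc (p ∘ suc) n)) (sym (+-assoc (bit (p 0)) _ _))

  countBelow-cong : ∀ {p q} n → (∀ {j} → j < n → p j ≡ q j) → countBelow p n ≡ countBelow q n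
  countBelow-cong zero p≗q = refl
  countBelow-cong (suc n) p≗q = cong₂ _+_ (cong bit (p≗q z<s)) (countBelow-cong n (λ j<n → p≗q (s<s j<n)))

  allB-applyUpTo⁺ : ∀ p (f : ℕ → ℕ) K → T (allB p (applyUpTo f K)) → ∀ {k} → k < K → T (p (f k))
  allB-applyUpTo⁺ p f (suc K) all {zero} _ = proj₁ (to T-∧ all)
  allB-applyUpTo⁺ p f (suc K) all {suc k} (s<s k<K) =
    allB-applyUpTo⁺ p (f ∘ suc) K (proj₂ (to (T-∧ {p (f 0)}) all)) k<K

  allB-applyUpTo⁻ : ∀ p (f : ℕ → ℕ) K → (∀ {k} → k < K → T (p (f k))) → T (allB p (applyUpTo f K))
  allB-applyUpTo⁻ p f zero all = _
  allB-applyUpTo⁻ p f (suc K) all = from T-∧ (all z<s , allB-applyUpTo⁻ p (f ∘ suc) K (all ∘ s<s))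

  allB-cong : ∀ {A : Set} {p q : A → Bool} xs → (∀ x → p x ≡ q x) → allB p xs ≡ allB q xs
  allB-cong [] p≗q = refl
  allB-cong (x ∷ xs) p≗q = cong₂ _∧_ (p≗q x) (allB-cong xs p≗q)

module Permutation where

  open import Data.Nat using (ℕ; zero; suc; _+_; _∸_; _<_; _≤_; _≤ᵇ_; s≤s)
  open import Data.Nat.Properties
  open import Data.Nat.Induction using (<-wellFounded)
  open import Induction.WellFounded using (Acc; acc)
  open import Data.Bool using (Bool; true; false; if_then_else_; T; not; _∧_)
  open import Data.Fin using (Fin; toℕ; fromℕ<)
  import Data.Fin.Properties as Fin
  open import Data.List using (upTo)
  open import Data.Product using (_×_; _,_; proj₁; proj₂; ∃-syntax)
  open import Data.Sum using (_⊎_; inj₁; inj₂)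
  open import Data.Empty using (⊥-elim)
  open import Function using (_∘_; id; mk⇔)
  open import Relation.Nullary using (yes; no; does)
  open import Relation.Nullary.Decidable using (T?; dec-true; dec-false; does-⇔)
  open import Relation.Binary.PropositionalEquality
  open import Data.Integer as ℤ using (ℤ)
  import Data.Integer.Properties as ℤ
  open import Defs using (allB)
  open Booleans

  pigeonholeℕ : ∀ n (f : ℕ → ℕ) → (∀ {j} → j ≤ n → f j < n) →
                ∃[ i ] ∃[ j ] (i < j × j ≤ n × f i ≡ f j)
  pigeonholeℕ n f f<n with Fin.pigeonhole (n<1+n n) (λ k → fromℕ< (f<n (bound k)))
    where
    bound : (k : Fin (suc n)) → toℕ k ≤ n
    bound k = ≤-pred (Fin.toℕ<n k)
  ... | i , j , i<j , fi≡fj =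
    toℕ i , toℕ j , i<j , ≤-pred (Fin.toℕ<n j) , Fin.fromℕ<-injective _ _ _ _ fi≡fj

  m<1+n∧m≢n⇒m<n : ∀ {m n} → m < suc n → m ≢ n → m < n
  m<1+n∧m≢n⇒m<n m<1+n m≢n = ≤∧≢⇒< (≤-pred m<1+n) m≢n

  iterate : (ℕ → ℕ) → ℕ → ℕ → ℕ
  iterate t zero i = i
  iterate t (suc k) i = t (iterate t k i)

  iterate-+ : ∀ t r p i → iterate t (r + p) i ≡ iterate t r (iterate t p i)
  iterate-+ t zero p i = refl
  iterate-+ t (suc r) p i = cong t (iterate-+ t r p i)

  iterate-fixed : ∀ {t m} → t m ≡ m → ∀ k → iterate t k m ≡ m
  iterate-fixed tm≡m zero = refl
  iterate-fixed {t} tm≡m (suc k) = trans (cong t (iterate-fixed tm≡m k)) tm≡m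

  iterate-≗ : ∀ {t u} → (∀ j → t j ≡ u j) → ∀ k i → iterate t k i ≡ iterate u k i
  iterate-≗ t≗u zero i = refl
  iterate-≗ {u = u} t≗u (suc k) i = trans (t≗u _) (cong u (iterate-≗ t≗u k i))

  MapsBelow : ℕ → (ℕ → ℕ) → Set
  MapsBelow n t = ∀ {j} → j < n → t j < n

  InjectiveBelow : ℕ → (ℕ → ℕ) → Set
  InjectiveBelow n t = ∀ {i j} → i < n → j < n → t i ≡ t j → i ≡ j

  IsPermutation : ℕ → (ℕ → ℕ) → Set
  IsPermutation n t = MapsBelow n t × InjectiveBelow n t

  iterate-< : ∀ {n t i} → MapsBelow n t → i < n → ∀ k → iterate t k i < n
  iterate-< closed i<n zero = i<n
  iterate-< closed i<n (suc k) = closed (iterate-< closed i<n k)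

  iterate-cong : ∀ {n t u} → MapsBelow n t → (∀ {j} → j < n → t j ≡ u j) →
                 ∀ {i} → i < n → ∀ k → iterate t k i ≡ iterate u k i
  iterate-cong closed t≗u i<n zero = refl
  iterate-cong {u = u} closed t≗u i<n (suc k) =
    trans (t≗u (iterate-< closed i<n k)) (cong u (iterate-cong closed t≗u i<n k))

  iterate-periodic : ∀ {t p l i} → iterate t p i ≡ iterate t l i →
                     ∀ r → iterate t (r + l) i ≡ iterate t (r + p) i
  iterate-periodic {t} {p} {l} {i} tᵖi≡tˡi r = begin
    iterate t (r + l) i         ≡⟨ iterate-+ t r l i ⟩
    iterate t r (iterate t l i) ≡⟨ cong (iterate t r) tᵖi≡tˡi ⟨
    iterate t r (iterate t p i) ≡⟨ iterate-+ t r p i ⟨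
    iterate t (r + p) i         ∎
    where open ≡-Reasoning

  -- Pigeonhole yields a repetition t^p i = t^l i with p < l ≤ n, which lets us lower any exponent ≥ l by l − p.
  iterate-reduce : ∀ {n t i} → MapsBelow n t → i < n →
                   ∀ k → ∃[ k′ ] (k′ ≤ n × iterate t k i ≡ iterate t k′ i)
  iterate-reduce {n} {t} {i} closed i<n
    with pigeonholeℕ n (λ j → iterate t j i) (λ {j} _ → iterate-< closed i<n j)
  ... | p , l , p<l , l≤n , tᵖi≡tˡi = λ k → go k (<-wellFounded k)
    where
    go : ∀ k → Acc _<_ k → ∃[ k′ ] (k′ ≤ n × iterate t k i ≡ iterate t k′ i)
    go k (acc smaller) with k <? l
    ... | yes k<l = k , ≤-trans (<⇒≤ k<l) l≤n , refl
    ... | no k≮l = let k′ , k′≤n , tʳ⁺ᵖi≡tᵏ′i = go (r + p) (smaller r+p<k) in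
                   k′ , k′≤n , trans tᵏi≡tʳ⁺ᵖi tʳ⁺ᵖi≡tᵏ′i
      where
      r : ℕ
      r = k ∸ l
      k≡r+l : k ≡ r + l
      k≡r+l = sym (m∸n+n≡m (≮⇒≥ k≮l))
      r+p<k : r + p < k
      r+p<k = subst (r + p <_) (sym k≡r+l) (+-monoʳ-< r p<l)
      tᵏi≡tʳ⁺ᵖi : iterate t k i ≡ iterate t (r + p) i
      tᵏi≡tʳ⁺ᵖi = trans (cong (λ e → iterate t e i) k≡r+l) (iterate-periodic tᵖi≡tˡi r)

  IsCycleMin : (ℕ → ℕ) → ℕ → Set
  IsCycleMin t i = ∀ k → i ≤ iterate t k i

  isCycleMinᵇ : ℕ → (ℕ → ℕ) → ℕ → Bool
  isCycleMinᵇ n t i = allB (λ k → i ≤ᵇ iterate t k i) (upTo (suc n))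

  isCycleMinᵇ-sound : ∀ {n t i} → MapsBelow n t → i < n → T (isCycleMinᵇ n t i) → IsCycleMin t i
  isCycleMinᵇ-sound {n} {t} {i} closed i<n minᵇ k =
    let k′ , k′≤n , tᵏi≡tᵏ′i = iterate-reduce closed i<n k in
    subst (i ≤_) (sym tᵏi≡tᵏ′i)
      (≤ᵇ⇒≤ i _ (allB-applyUpTo⁺ (λ k → i ≤ᵇ iterate t k i) id (suc n) minᵇ (s≤s k′≤n)))

  isCycleMinᵇ-complete : ∀ {n t i} → IsCycleMin t i → T (isCycleMinᵇ n t i)
  isCycleMinᵇ-complete {n} {t} {i} min =
    allB-applyUpTo⁻ (λ k → i ≤ᵇ iterate t k i) id (suc n) (λ {k} _ → ≤⇒≤ᵇ (min k))

  cycles : ℕ → (ℕ → ℕ) → ℕ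
  cycles n t = countBelow (isCycleMinᵇ n t) n

  cycles-cong : ∀ {n t u} → MapsBelow n t → (∀ {j} → j < n → t j ≡ u j) → cycles n t ≡ cycles n u
  cycles-cong {n} closed t≗u = countBelow-cong n (λ {i} i<n →
    allB-cong (upTo (suc n)) (λ k → cong (i ≤ᵇ_) (iterate-cong closed t≗u i<n k)))

  cycles-≗ : ∀ n {t u} → (∀ j → t j ≡ u j) → cycles n t ≡ cycles n u
  cycles-≗ n t≗u = countBelow-cong n (λ {i} _ →
    allB-cong (upTo (suc n)) (λ k → cong (i ≤ᵇ_) (iterate-≗ t≗u k i)))

  -- Splices m out of its cycle of t.
  removeTop : ℕ → (ℕ → ℕ) → ℕ → ℕ
  removeTop m t j = if does (t j ≟ m) then t m else t j

  removeTop-hit : ∀ {m t j} → t j ≡ m → removeTop m t j ≡ t m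
  removeTop-hit {m} {t} {j} tj≡m rewrite dec-true (t j ≟ m) tj≡m = refl

  removeTop-miss : ∀ {m t j} → t j ≢ m → removeTop m t j ≡ t j
  removeTop-miss {m} {t} {j} tj≢m rewrite dec-false (t j ≟ m) tj≢m = refl

  removeTop-cases : ∀ m t j → (t j ≡ m × removeTop m t j ≡ t m) ⊎ (t j ≢ m × removeTop m t j ≡ t j)
  removeTop-cases m t j with t j ≟ m
  ... | yes tj≡m = inj₁ (tj≡m , removeTop-hit {t = t} tj≡m)
  ... | no tj≢m = inj₂ (tj≢m , removeTop-miss {t = t} tj≢m)

  IsPermutation-removeTop : ∀ {m t} → IsPermutation (suc m) t → IsPermutation m (removeTop m t)
  IsPermutation-removeTop {m} {t} (closed , inj) = closed′ , inj′
    where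
    <1+m : ∀ {j} → j < m → j < suc m
    <1+m j<m = m<n⇒m<1+n j<m
    tm≢m : ∀ {j} → j < m → t j ≡ m → t m ≢ m
    tm≢m j<m tj≡m tm≡m = <⇒≢ j<m (inj (<1+m j<m) (n<1+n m) (trans tj≡m (sym tm≡m)))
    closed′ : MapsBelow m (removeTop m t)
    closed′ {j} j<m with removeTop-cases m t j
    ... | inj₁ (tj≡m , r≡tm) = subst (_< m) (sym r≡tm) (m<1+n∧m≢n⇒m<n (closed (n<1+n m)) (tm≢m j<m tj≡m))
    ... | inj₂ (tj≢m , r≡tj) = subst (_< m) (sym r≡tj) (m<1+n∧m≢n⇒m<n (closed (<1+m j<m)) tj≢m)
    inj′ : InjectiveBelow m (removeTop m t)
    inj′ {i} {j} i<m j<m rᵢ≡rⱼ with removeTop-cases m t i | removeTop-cases m t j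
    ... | inj₁ (ti≡m , _) | inj₁ (tj≡m , _) = inj (<1+m i<m) (<1+m j<m) (trans ti≡m (sym tj≡m))
    ... | inj₁ (_ , rᵢ≡tm) | inj₂ (_ , rⱼ≡tj) =
      ⊥-elim (<⇒≢ j<m (sym (inj (n<1+n m) (<1+m j<m) (trans (sym rᵢ≡tm) (trans rᵢ≡rⱼ rⱼ≡tj)))))
    ... | inj₂ (_ , rᵢ≡ti) | inj₁ (_ , rⱼ≡tm) =
      ⊥-elim (<⇒≢ i<m (inj (<1+m i<m) (n<1+n m) (trans (sym rᵢ≡ti) (trans rᵢ≡rⱼ rⱼ≡tm))))
    ... | inj₂ (_ , rᵢ≡ti) | inj₂ (_ , rⱼ≡tj) =
      inj (<1+m i<m) (<1+m j<m) (trans (sym rᵢ≡ti) (trans rᵢ≡rⱼ rⱼ≡tj))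

  iterate-removeTop⊆ : ∀ m t i k → ∃[ k′ ] (iterate (removeTop m t) k i ≡ iterate t k′ i)
  iterate-removeTop⊆ m t i zero = 0 , refl
  iterate-removeTop⊆ m t i (suc k) with iterate-removeTop⊆ m t i k
  ... | k′ , rᵏi≡tᵏ′i with removeTop-cases m t (iterate t k′ i)
  ...   | inj₁ (tʸ≡m , r≡tm) =
    suc (suc k′) , trans (cong (removeTop m t) rᵏi≡tᵏ′i) (trans r≡tm (cong t (sym tʸ≡m)))
  ...   | inj₂ (_ , r≡ty) = suc k′ , trans (cong (removeTop m t) rᵏi≡tᵏ′i) r≡ty

  OnRemovedOrbit : ℕ → (ℕ → ℕ) → ℕ → ℕ → Set
  OnRemovedOrbit m t i k = iterate t k i ≢ m → ∃[ k′ ] (iterate t k i ≡ iterate (removeTop m t) k′ i)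

  -- If t^(k+1) i = m is skipped, its successor t^(k+2) i = t m follows t^k i directly in removeTop m t.
  onRemovedOrbit-step : ∀ {m t i k} → OnRemovedOrbit m t i k → OnRemovedOrbit m t i (suc k) →
                        OnRemovedOrbit m t i (suc (suc k))
  onRemovedOrbit-step {m} {t} {i} {k} onᵏ onᵏ⁺¹ tᵏ⁺²i≢m with iterate t (suc k) i ≟ m
  ... | no tᵏ⁺¹i≢m =
    let k′ , e = onᵏ⁺¹ tᵏ⁺¹i≢m in
    suc k′ , trans (cong t e) (sym (removeTop-miss {t = t} (subst (λ y → t y ≢ m) e tᵏ⁺²i≢m)))
  ... | yes tᵏ⁺¹i≡m =
    let k′ , e = onᵏ tᵏi≢m in
    suc k′ , trans (cong t tᵏ⁺¹i≡m)
                   (sym (trans (cong (removeTop m t) (sym e)) (removeTop-hit {t = t} tᵏ⁺¹i≡m)))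
    where
    tᵏi≢m : iterate t k i ≢ m
    tᵏi≢m tᵏi≡m = tᵏ⁺²i≢m (trans (cong t tᵏ⁺¹i≡m) (trans (cong t (sym tᵏi≡m)) tᵏ⁺¹i≡m))

  onRemovedOrbit : ∀ {m t i} → i ≢ m → ∀ k → OnRemovedOrbit m t i k × OnRemovedOrbit m t i (suc k)
  onRemovedOrbit {t = t} i≢m zero = (λ _ → 0 , refl) , (λ ti≢m → 1 , sym (removeTop-miss {t = t} ti≢m))
  onRemovedOrbit {m} {t} {i} i≢m (suc k) =
    let onᵏ , onᵏ⁺¹ = onRemovedOrbit i≢m k in onᵏ⁺¹ , onRemovedOrbit-step {m} {t} {i} {k} onᵏ onᵏ⁺¹

  isCycleMinᵇ-removeTop : ∀ {m t i} → IsPermutation (suc m) t → i < m →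
                          isCycleMinᵇ (suc m) t i ≡ isCycleMinᵇ m (removeTop m t) i
  isCycleMinᵇ-removeTop {m} {t} {i} perm@(closed , _) i<m = does-⇔ (mk⇔
    (λ minᵇ → isCycleMinᵇ-complete {m} (λ k →
       let k′ , e = iterate-removeTop⊆ m t i k in
       subst (i ≤_) (sym e) (isCycleMinᵇ-sound closed (m<n⇒m<1+n i<m) minᵇ k′)))
    (λ minᵇ → isCycleMinᵇ-complete {suc m}
                (fromRemoved (isCycleMinᵇ-sound (proj₁ (IsPermutation-removeTop perm)) i<m minᵇ))))
    (T? _) (T? _)
    where
    fromRemoved : IsCycleMin (removeTop m t) i → IsCycleMin t i
    fromRemoved min k with iterate t k i ≟ m
    ... | yes tᵏi≡m = subst (i ≤_) (sym tᵏi≡m) (<⇒≤ i<m)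
    ... | no tᵏi≢m =
      let k′ , e = proj₁ (onRemovedOrbit {m} {t} (<⇒≢ i<m) k) tᵏi≢m in subst (i ≤_) (sym e) (min k′)

  isCycleMinᵇ-top : ∀ {m t} → IsPermutation (suc m) t → isCycleMinᵇ (suc m) t m ≡ does (t m ≟ m)
  isCycleMinᵇ-top {m} {t} (closed , _) with t m ≟ m
  ... | yes tm≡m =
    trans (dec-true (T? _) (isCycleMinᵇ-complete {suc m} {t} (λ k → ≤-reflexive (sym (iterate-fixed tm≡m k)))))
          (sym (dec-true (t m ≟ m) tm≡m))
  ... | no tm≢m = trans (dec-false (T? _) (λ minᵇ →
                    tm≢m (≤-antisym (≤-pred (closed (n<1+n m))) (isCycleMinᵇ-sound closed (n<1+n m) minᵇ 1))))
                        (sym (dec-false (t m ≟ m) tm≢m))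

  cycles-removeTop : ∀ {m t} → IsPermutation (suc m) t →
                     cycles (suc m) t ≡ bit (does (t m ≟ m)) + cycles m (removeTop m t)
  cycles-removeTop {m} {t} perm = begin
    cycles (suc m) t
      ≡⟨ countBelow-suc (isCycleMinᵇ (suc m) t) m ⟩
    countBelow (isCycleMinᵇ (suc m) t) m + bit (isCycleMinᵇ (suc m) t m)
      ≡⟨ cong₂ _+_ (countBelow-cong m (isCycleMinᵇ-removeTop perm)) (cong bit (isCycleMinᵇ-top perm)) ⟩
    cycles m (removeTop m t) + bit (does (t m ≟ m))
      ≡⟨ +-comm (cycles m (removeTop m t)) _ ⟩
    bit (does (t m ≟ m)) + cycles m (removeTop m t) ∎
    where open ≡-Reasoning

  top-preimage : ∀ {m t} → IsPermutation (suc m) t → ∃[ p ] (p < suc m × t p ≡ m)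
  top-preimage {m} {t} (closed , inj) with Fin.any? (λ (k : Fin (suc m)) → t (toℕ k) ≟ m)
  ... | yes (k , tk≡m) = toℕ k , Fin.toℕ<n k , tk≡m
  ... | no ∄p with pigeonholeℕ m t (λ {j} j≤m → m<1+n∧m≢n⇒m<n (closed (s≤s j≤m)) (missed j≤m))
    where
    missed : ∀ {j} → j ≤ m → t j ≢ m
    missed j≤m tj≡m = ∄p (fromℕ< (s≤s j≤m) , trans (cong t (Fin.toℕ-fromℕ< (s≤s j≤m))) tj≡m)
  ...   | i , j , i<j , j≤m , ti≡tj = ⊥-elim (<⇒≢ i<j (inj (<-trans i<j (s≤s j≤m)) (s≤s j≤m) ti≡tj))

  swap : ℕ → ℕ → ℕ → ℕ
  swap a b j = if does (j ≟ a) then b else if does (j ≟ b) then a else j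

  swap-left : ∀ a b → swap a b a ≡ b
  swap-left a b rewrite dec-true (a ≟ a) refl = refl

  swap-right : ∀ a b → swap a b b ≡ a
  swap-right a b with b ≟ a
  ... | yes refl = swap-left b b
  ... | no b≢a rewrite dec-false (b ≟ a) b≢a | dec-true (b ≟ b) refl = refl

  swap-other : ∀ {a b j} → j ≢ a → j ≢ b → swap a b j ≡ j
  swap-other {a} {b} {j} j≢a j≢b rewrite dec-false (j ≟ a) j≢a | dec-false (j ≟ b) j≢b = refl

  data SwapView (a b j : ℕ) : Set where
    left : j ≡ a → SwapView a b j
    right : j ≢ a → j ≡ b → SwapView a b j
    other : j ≢ a → j ≢ b → SwapView a b j

  swapView : ∀ a b j → SwapView a b j
  swapView a b j with j ≟ a | j ≟ b
  ... | yes j≡a | _ = left j≡a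
  ... | no j≢a | yes j≡b = right j≢a j≡b
  ... | no j≢a | no j≢b = other j≢a j≢b

  swap-comm : ∀ a b j → swap a b j ≡ swap b a j
  swap-comm a b j with swapView a b j
  ... | left refl = trans (swap-left j b) (sym (swap-right b j))
  ... | right _ refl = trans (swap-right a j) (sym (swap-left j a))
  ... | other j≢a j≢b = trans (swap-other j≢a j≢b) (sym (swap-other j≢b j≢a))

  swap-involutive : ∀ a b j → swap a b (swap a b j) ≡ j
  swap-involutive a b j with swapView a b j
  ... | left refl = trans (cong (swap j b) (swap-left j b)) (swap-right j b)
  ... | right _ refl = trans (cong (swap a j) (swap-right a j)) (swap-left a j)
  ... | other j≢a j≢b = trans (cong (swap a b) (swap-other j≢a j≢b)) (swap-other j≢a j≢b)

  swap-< : ∀ {n a b j} → a < n → b < n → j < n → swap a b j < n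
  swap-< {a = a} {b} {j} a<n b<n j<n with swapView a b j
  ... | left refl = subst (_< _) (sym (swap-left j b)) b<n
  ... | right _ refl = subst (_< _) (sym (swap-right a j)) a<n
  ... | other j≢a j≢b = subst (_< _) (sym (swap-other j≢a j≢b)) j<n

  IsPermutation-∘swap : ∀ {n t a b} → IsPermutation n t → a < n → b < n → IsPermutation n (t ∘ swap a b)
  IsPermutation-∘swap {a = a} {b} (closed , inj) a<n b<n =
    (λ j<n → closed (swap-< a<n b<n j<n)) ,
    (λ {i} {j} i<n j<n tsᵢ≡tsⱼ → begin
      i                       ≡⟨ swap-involutive a b i ⟨
      swap a b (swap a b i)   ≡⟨ cong (swap a b) (inj (swap-< a<n b<n i<n) (swap-< a<n b<n j<n) tsᵢ≡tsⱼ) ⟩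
      swap a b (swap a b j)   ≡⟨ swap-involutive a b j ⟩
      j                       ∎)
    where open ≡-Reasoning

  sgn : ℕ → ℤ
  sgn c = (ℤ.- ℤ.+ 1) ℤ.^ c

  sgn-+ : ∀ a b → sgn (a + b) ≡ sgn a ℤ.* sgn b
  sgn-+ = ℤ.^-distribˡ-+-* (ℤ.- ℤ.+ 1)

  sgn-bit-not : ∀ b → sgn (bit (not b)) ≡ ℤ.- sgn (bit b)
  sgn-bit-not true = refl
  sgn-bit-not false = refl

  sgn-cycles-removeTop : ∀ {m t} → IsPermutation (suc m) t →
                         sgn (cycles (suc m) t) ≡ sgn (bit (does (t m ≟ m))) ℤ.* sgn (cycles m (removeTop m t))
  sgn-cycles-removeTop {m} {t} perm = trans (cong sgn (cycles-removeTop perm)) (sgn-+ (bit (does (t m ≟ m))) _)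

  ReversesSign : ℕ → (ℕ → ℕ) → (ℕ → ℕ) → Set
  ReversesSign n t u = sgn (cycles n u) ≡ ℤ.- sgn (cycles n t)

  reversesSign-topBit : ∀ {m t u} → IsPermutation (suc m) t → IsPermutation (suc m) u →
                        does (u m ≟ m) ≡ not (does (t m ≟ m)) →
                        (∀ {j} → j < m → removeTop m u j ≡ removeTop m t j) → ReversesSign (suc m) t u
  reversesSign-topBit {m} {t} {u} perm-t perm-u bit-flips rest-agrees = begin
    sgn (cycles (suc m) u)
      ≡⟨ sgn-cycles-removeTop perm-u ⟩
    sgn (bit (does (u m ≟ m))) ℤ.* sgn (cycles m (removeTop m u))
      ≡⟨ cong₂ (λ b c → sgn (bit b) ℤ.* sgn c) bit-flips
               (cycles-cong (proj₁ (IsPermutation-removeTop perm-u)) rest-agrees) ⟩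
    sgn (bit (not (does (t m ≟ m)))) ℤ.* sgn (cycles m (removeTop m t))
      ≡⟨ cong (ℤ._* sgn (cycles m (removeTop m t))) (sgn-bit-not (does (t m ≟ m))) ⟩
    ℤ.- sgn (bit (does (t m ≟ m))) ℤ.* sgn (cycles m (removeTop m t))
      ≡⟨ ℤ.neg-distribˡ-* (sgn (bit (does (t m ≟ m)))) (sgn (cycles m (removeTop m t))) ⟨
    ℤ.- (sgn (bit (does (t m ≟ m))) ℤ.* sgn (cycles m (removeTop m t)))
      ≡⟨ cong ℤ.-_ (sgn-cycles-removeTop perm-t) ⟨
    ℤ.- sgn (cycles (suc m) t) ∎
    where open ≡-Reasoning

  reversesSign-rest : ∀ {m t u} → IsPermutation (suc m) t → IsPermutation (suc m) u →
                      does (u m ≟ m) ≡ does (t m ≟ m) →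
                      ReversesSign m (removeTop m t) (removeTop m u) → ReversesSign (suc m) t u
  reversesSign-rest {m} {t} {u} perm-t perm-u same-bit rest-reverses = begin
    sgn (cycles (suc m) u)
      ≡⟨ sgn-cycles-removeTop perm-u ⟩
    sgn (bit (does (u m ≟ m))) ℤ.* sgn (cycles m (removeTop m u))
      ≡⟨ cong₂ (λ b s → sgn (bit b) ℤ.* s) same-bit rest-reverses ⟩
    sgn (bit (does (t m ≟ m))) ℤ.* ℤ.- sgn (cycles m (removeTop m t))
      ≡⟨ ℤ.neg-distribʳ-* (sgn (bit (does (t m ≟ m)))) (sgn (cycles m (removeTop m t))) ⟨
    ℤ.- (sgn (bit (does (t m ≟ m))) ℤ.* sgn (cycles m (removeTop m t)))
      ≡⟨ cong ℤ.-_ (sgn-cycles-removeTop perm-t) ⟨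
    ℤ.- sgn (cycles (suc m) t) ∎
    where open ≡-Reasoning

  removeTop-bothMiss : ∀ {m t u j j′} → u j ≡ t j′ → t j′ ≢ m → removeTop m u j ≡ removeTop m t j′
  removeTop-bothMiss {t = t} {u = u} uj≡tj′ tj′≢m =
    trans (removeTop-miss {t = u} (tj′≢m ∘ trans (sym uj≡tj′)))
          (trans uj≡tj′ (sym (removeTop-miss {t = t} tj′≢m)))

  module SwapWithTop {m t a} (perm : IsPermutation (suc m) t) (a<m : a < m) where

    u : ℕ → ℕ
    u = t ∘ swap a m

    ↑ : ∀ {j} → j < m → j < suc m
    ↑ = m<n⇒m<1+n

    perm-u : IsPermutation (suc m) u
    perm-u = IsPermutation-∘swap perm (↑ a<m) (n<1+n m)

    u-a : u a ≡ t m
    u-a = cong t (swap-left a m)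

    u-m : u m ≡ t a
    u-m = cong t (swap-right a m)

    t≢m : ∀ {j p} → j < suc m → p < suc m → j ≢ p → t p ≡ m → t j ≢ m
    t≢m j< p< j≢p tp≡m tj≡m = j≢p (proj₂ perm j< p< (trans tj≡m (sym tp≡m)))

    removeTop-a : t m ≢ m → removeTop m u a ≡ t m
    removeTop-a tm≢m = trans (removeTop-miss {t = u} {j = a} (tm≢m ∘ trans (sym u-a))) u-a

    removeTop-other : ∀ {j} → j ≢ a → j < m → t j ≢ m → removeTop m u j ≡ removeTop m t j
    removeTop-other {j} j≢a j<m = removeTop-bothMiss {t = t} {u = u} {j} {j} (cong t (swap-other j≢a (<⇒≢ j<m)))

    removeTop-fixedTop : t m ≡ m → ∀ {j} → j < m → removeTop m u j ≡ removeTop m t j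
    removeTop-fixedTop tm≡m {j} j<m with j ≟ a
    ... | yes refl = trans (removeTop-hit {t = u} {j = a} (trans u-a tm≡m))
                           (trans u-m (sym (removeTop-miss {t = t} (t≢m (↑ a<m) (n<1+n m) (<⇒≢ a<m) tm≡m))))
    ... | no j≢a = removeTop-other j≢a j<m (t≢m (↑ j<m) (n<1+n m) (<⇒≢ j<m) tm≡m)

    removeTop-aToTop : t a ≡ m → t m ≢ m → ∀ {j} → j < m → removeTop m u j ≡ removeTop m t j
    removeTop-aToTop ta≡m tm≢m {j} j<m with j ≟ a
    ... | yes refl = trans (removeTop-a tm≢m) (sym (removeTop-hit {t = t} ta≡m))
    ... | no j≢a = removeTop-other j≢a j<m (t≢m (↑ j<m) (↑ a<m) j≢a ta≡m)

    removeTop-generic : ∀ {p} → p < m → t p ≡ m → p ≢ a → t m ≢ m → t a ≢ m →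
                        ∀ {j} → j < m → removeTop m u j ≡ removeTop m t (swap a p j)
    removeTop-generic {p} p<m tp≡m p≢a tm≢m ta≢m {j} j<m with swapView a p j
    ... | left refl = begin
      removeTop m u j             ≡⟨ removeTop-a tm≢m ⟩
      t m                         ≡⟨ removeTop-hit {t = t} tp≡m ⟨
      removeTop m t p             ≡⟨ cong (removeTop m t) (swap-left j p) ⟨
      removeTop m t (swap j p j)  ∎
      where open ≡-Reasoning
    ... | right j≢a refl = begin
      removeTop m u j             ≡⟨ removeTop-hit {t = u} {j = j} (trans (cong t (swap-other j≢a (<⇒≢ j<m))) tp≡m) ⟩
      u m                         ≡⟨ u-m ⟩
      t a                         ≡⟨ removeTop-miss {t = t} ta≢m ⟨
      removeTop m t a             ≡⟨ cong (removeTop m t) (swap-right a j) ⟨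
      removeTop m t (swap a j j)  ∎
      where open ≡-Reasoning
    ... | other j≢a j≢p = trans (removeTop-other j≢a j<m (t≢m (↑ j<m) (↑ p<m) j≢p tp≡m))
                                (cong (removeTop m t) (sym (swap-other j≢a j≢p)))

  SwapReversesSign : ℕ → Set
  SwapReversesSign n =
    ∀ {t a b} → IsPermutation n t → a < n → b < n → a ≢ b → ReversesSign n t (t ∘ swap a b)

  -- Removing the top either flips the fixed-point bit of m (when t m = m or t a = m) or, writing t p = m,
  -- turns the swap with m into the swap with p one level down.
  swapWithTop-reversesSign : ∀ {m} → SwapReversesSign m →
                             ∀ {t a} → IsPermutation (suc m) t → a < m → ReversesSign (suc m) t (t ∘ swap a m)
  swapWithTop-reversesSign {m} ih {t} {a} perm a<m with t m ≟ m | t a ≟ m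
  ... | yes tm≡m | _ = reversesSign-topBit perm perm-u
        (trans (dec-false (u m ≟ m) (t≢m (↑ a<m) (n<1+n m) (<⇒≢ a<m) tm≡m ∘ trans (sym u-m)))
               (cong not (sym (dec-true (t m ≟ m) tm≡m))))
        (removeTop-fixedTop tm≡m)
    where open SwapWithTop perm a<m
  ... | no tm≢m | yes ta≡m = reversesSign-topBit perm perm-u
        (trans (dec-true (u m ≟ m) (trans u-m ta≡m)) (cong not (sym (dec-false (t m ≟ m) tm≢m))))
        (removeTop-aToTop ta≡m tm≢m)
    where open SwapWithTop perm a<m
  ... | no tm≢m | no ta≢m with top-preimage perm
  ...   | p , p<1+m , tp≡m = reversesSign-rest perm perm-u
          (trans (dec-false (u m ≟ m) (ta≢m ∘ trans (sym u-m))) (sym (dec-false (t m ≟ m) tm≢m)))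
          (trans (cong sgn (cycles-cong (proj₁ (IsPermutation-removeTop perm-u))
                                        (removeTop-generic p<m tp≡m p≢a tm≢m ta≢m)))
                 (ih (IsPermutation-removeTop perm) a<m p<m (p≢a ∘ sym)))
    where
    open SwapWithTop perm a<m
    p≢a : p ≢ a
    p≢a refl = ta≢m tp≡m
    p<m : p < m
    p<m = m<1+n∧m≢n⇒m<n p<1+m (λ { refl → tm≢m tp≡m })

  swap-reversesSign : ∀ n → SwapReversesSign n
  swap-reversesSign (suc m) {t} {a} {b} perm a<n b<n a≢b with a ≟ m | b ≟ m
  ... | yes refl | yes refl = ⊥-elim (a≢b refl)
  ... | no a≢m | yes refl = swapWithTop-reversesSign (swap-reversesSign m) perm (m<1+n∧m≢n⇒m<n a<n a≢m)
  ... | yes refl | no b≢m =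
    trans (cong sgn (cycles-≗ (suc m) (cong t ∘ swap-comm a b)))
          (swapWithTop-reversesSign (swap-reversesSign m) perm (m<1+n∧m≢n⇒m<n b<n b≢m))
  ... | no a≢m | no b≢m = reversesSign-rest perm (IsPermutation-∘swap perm a<n b<n)
        (cong (λ x → does (x ≟ m)) u-m)
        (trans (cong sgn (cycles-≗ m removeTop-u))
               (swap-reversesSign m (IsPermutation-removeTop perm) a<m b<m a≢b))
    where
    a<m : a < m
    a<m = m<1+n∧m≢n⇒m<n a<n a≢m
    b<m : b < m
    b<m = m<1+n∧m≢n⇒m<n b<n b≢m
    u-m : t (swap a b m) ≡ t m
    u-m = cong t (swap-other (a≢m ∘ sym) (b≢m ∘ sym))
    removeTop-u : ∀ j → removeTop m (t ∘ swap a b) j ≡ removeTop m t (swap a b j)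
    removeTop-u j = cong (λ y → if does (t (swap a b j) ≟ m) then y else t (swap a b j)) u-m

module OneLine where

  open import Data.Nat using (ℕ; zero; suc; _<_; s<s)
  open import Data.Nat.Properties
  open import Data.Bool using (Bool; true; false; if_then_else_; not; _∧_; T)
  open import Data.Bool.Properties using (∧-assoc; ∧-comm; T-∧; ∧-commutativeMonoid)
  open import Algebra.Bundles using (CommutativeMonoid)
  open import Algebra.Properties.CommutativeSemigroup
    (CommutativeMonoid.commutativeSemigroup ∧-commutativeMonoid) using (interchange)
  open import Data.List using (List; []; _∷_; [_]; _++_; map; upTo)
  open import Data.List.Properties using (upTo-∷ʳ)
  open import Data.List.Membership.Propositional using (_∈_)
  open import Data.List.Membership.Propositional.Properties using (∈-upTo⁻)
  open import Data.Vec using (Vec; []; _∷_; toList; _∷ʳ_)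
  open import Data.Empty using (⊥-elim)
  open import Data.Product using (_,_; proj₁; proj₂)
  open import Function using (_∘_; Equivalence; mk⇔)
  open import Relation.Nullary using (¬_; yes; no; does)
  open import Relation.Nullary.Decidable using (dec-true; dec-false; does-⇔)
  open import Relation.Binary using (tri<; tri≈; tri>)
  open import Relation.Binary.PropositionalEquality hiding ([_])
  open import Data.Integer as ℤ using (ℤ; +_)
  import Data.Integer.Properties as ℤ
  open import Defs using (allVecs)
  open ListSum
  open Booleans using (T-not-does⇒¬)
  open Permutation using (swap; swap-other; swap-<; IsPermutation)
  open Equivalence using (to)

  nth : ∀ {k} → Vec ℕ k → ℕ → ℕ
  nth [] _ = 0
  nth (x ∷ w) zero = x
  nth (x ∷ w) (suc j) = nth w j

  -- One-line notation: w lists τ(0), …, τ(n − 1), and τ is extended by the identity beyond n.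
  apply : ∀ {n} → Vec ℕ n → ℕ → ℕ
  apply {n} w j = if does (j <? n) then nth w j else j

  apply-< : ∀ {n} (w : Vec ℕ n) {j} → j < n → apply w j ≡ nth w j
  apply-< {n} w {j} j<n rewrite dec-true (j <? n) j<n = refl

  apply-≮ : ∀ {n} (w : Vec ℕ n) {j} → ¬ j < n → apply w j ≡ j
  apply-≮ {n} w {j} j≮n rewrite dec-false (j <? n) j≮n = refl

  freshᵇ : ℕ → List ℕ → Bool
  freshᵇ x [] = true
  freshᵇ x (y ∷ ys) = not (does (x ≟ y)) ∧ freshᵇ x ys

  distinctᵇ : List ℕ → Bool
  distinctᵇ [] = true
  distinctᵇ (x ∷ xs) = freshᵇ x xs ∧ distinctᵇ xs

  AllBelow : ℕ → ∀ {k} → Vec ℕ k → Set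
  AllBelow K {k} w = ∀ {j} → j < k → nth w j < K

  freshᵇ-nth : ∀ {k} x (w : Vec ℕ k) → T (freshᵇ x (toList w)) → ∀ {j} → j < k → nth w j ≢ x
  freshᵇ-nth x (y ∷ w) fresh {zero} _ y≡x =
    T-not-does⇒¬ (x ≟ y) (proj₁ (to (T-∧ {not (does (x ≟ y))}) fresh)) (sym y≡x)
  freshᵇ-nth x (y ∷ w) fresh {suc j} (s<s j<k) =
    freshᵇ-nth x w (proj₂ (to (T-∧ {not (does (x ≟ y))}) fresh)) j<k

  distinctᵇ-nth-injective : ∀ {k} (w : Vec ℕ k) → T (distinctᵇ (toList w)) →
                            ∀ {i j} → i < k → j < k → nth w i ≡ nth w j → i ≡ j
  distinctᵇ-nth-injective (x ∷ w) distinct {zero} {zero} _ _ _ = refl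
  distinctᵇ-nth-injective (x ∷ w) distinct {zero} {suc j} _ (s<s j<k) x≡wⱼ =
    ⊥-elim (freshᵇ-nth x w (proj₁ (to (T-∧ {freshᵇ x (toList w)}) distinct)) j<k (sym x≡wⱼ))
  distinctᵇ-nth-injective (x ∷ w) distinct {suc i} {zero} (s<s i<k) _ wᵢ≡x =
    ⊥-elim (freshᵇ-nth x w (proj₁ (to (T-∧ {freshᵇ x (toList w)}) distinct)) i<k wᵢ≡x)
  distinctᵇ-nth-injective (x ∷ w) distinct {suc i} {suc j} (s<s i<k) (s<s j<k) wᵢ≡wⱼ =
    cong suc (distinctᵇ-nth-injective w (proj₂ (to (T-∧ {freshᵇ x (toList w)}) distinct)) i<k j<k wᵢ≡wⱼ)

  IsPermutation-apply : ∀ {n} (w : Vec ℕ n) → T (distinctᵇ (toList w)) → AllBelow n w →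
                        IsPermutation n (apply w)
  IsPermutation-apply w distinct below =
    (λ j<n → subst (_< _) (sym (apply-< w j<n)) (below j<n)) ,
    (λ i<n j<n wᵢ≡wⱼ → distinctᵇ-nth-injective w distinct i<n j<n
                          (trans (sym (apply-< w i<n)) (trans wᵢ≡wⱼ (apply-< w j<n))))

  ∑-allVecs-suc : ∀ {A : Set} {k} (f : Vec A (suc k) → ℤ) (L : List A) →
                  ∑ f (allVecs (suc k) L) ≡ ∑ (λ x → ∑ (λ v → f (x ∷ v)) (allVecs k L)) L
  ∑-allVecs-suc {k = k} f L = trans (∑-concatMap f (λ x → map (x ∷_) (allVecs k L)) L)
                                    (∑-cong L (λ x → ∑-map f (x ∷_) (allVecs k L)))

  ∑-allVecs-cong : ∀ K k {f g : Vec ℕ k → ℤ} → (∀ w → AllBelow K w → f w ≡ g w) →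
                   ∑ f (allVecs k (upTo K)) ≡ ∑ g (allVecs k (upTo K))
  ∑-allVecs-cong K zero f≗g = cong (ℤ._+ + 0) (f≗g [] (λ ()))
  ∑-allVecs-cong K (suc k) {f} {g} f≗g = begin
    ∑ f (allVecs (suc k) (upTo K))
      ≡⟨ ∑-allVecs-suc f (upTo K) ⟩
    ∑ (λ x → ∑ (λ v → f (x ∷ v)) (allVecs k (upTo K))) (upTo K)
      ≡⟨ ∑-cong-∈ (upTo K) (λ x x∈ →
           ∑-allVecs-cong K k (λ v below → f≗g (x ∷ v) (extend (∈-upTo⁻ x∈) below))) ⟩
    ∑ (λ x → ∑ (λ v → g (x ∷ v)) (allVecs k (upTo K))) (upTo K)
      ≡⟨ ∑-allVecs-suc g (upTo K) ⟨
    ∑ g (allVecs (suc k) (upTo K)) ∎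
    where
    open ≡-Reasoning
    extend : ∀ {x} {v : Vec ℕ k} → x < K → AllBelow K v → AllBelow K (x ∷ v)
    extend x<K below {zero} _ = x<K
    extend x<K below {suc j} (s<s j<k) = below j<k

  swapLast : ∀ {A : Set} {m} → Vec A (suc (suc m)) → Vec A (suc (suc m))
  swapLast {m = zero} (x ∷ y ∷ []) = y ∷ x ∷ []
  swapLast {m = suc m} (x ∷ w) = x ∷ swapLast w

  ∑-allVecs-swapLast : ∀ {A : Set} m (f : Vec A (suc (suc m)) → ℤ) (L : List A) →
                       ∑ f (allVecs (suc (suc m)) L) ≡ ∑ (f ∘ swapLast) (allVecs (suc (suc m)) L)
  ∑-allVecs-swapLast zero f L = begin
    ∑ f (allVecs 2 L)
      ≡⟨ ∑-allVecs-suc f L ⟩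
    ∑ (λ x → ∑ (λ v → f (x ∷ v)) (allVecs 1 L)) L
      ≡⟨ ∑-cong L (λ x → ∑-allVecs-suc (λ v → f (x ∷ v)) L) ⟩
    ∑ (λ x → ∑ (λ y → f (x ∷ y ∷ []) ℤ.+ + 0) L) L
      ≡⟨ ∑-comm (λ x y → f (x ∷ y ∷ []) ℤ.+ + 0) L L ⟩
    ∑ (λ y → ∑ (λ x → f (x ∷ y ∷ []) ℤ.+ + 0) L) L
      ≡⟨ ∑-cong L (λ y → ∑-allVecs-suc (λ v → f (swapLast (y ∷ v))) L) ⟨
    ∑ (λ y → ∑ (λ v → f (swapLast (y ∷ v))) (allVecs 1 L)) L
      ≡⟨ ∑-allVecs-suc (f ∘ swapLast) L ⟨
    ∑ (f ∘ swapLast) (allVecs 2 L) ∎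
    where open ≡-Reasoning
  ∑-allVecs-swapLast (suc m) f L =
    trans (∑-allVecs-suc f L)
          (trans (∑-cong L (λ x → ∑-allVecs-swapLast m (λ v → f (x ∷ v)) L))
                 (sym (∑-allVecs-suc (f ∘ swapLast) L)))

  swap-suc : ∀ a b j → swap (suc a) (suc b) (suc j) ≡ suc (swap a b j)
  swap-suc a b j with does (j ≟ a)
  ... | true = refl
  ... | false with does (j ≟ b)
  ...   | true = refl
  ...   | false = refl

  nth-swapLast : ∀ m (w : Vec ℕ (suc (suc m))) j → nth (swapLast w) j ≡ nth w (swap m (suc m) j)
  nth-swapLast zero (x ∷ y ∷ []) zero = refl
  nth-swapLast zero (x ∷ y ∷ []) (suc zero) = refl
  nth-swapLast zero (x ∷ y ∷ []) (suc (suc j)) = refl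
  nth-swapLast (suc m) (x ∷ w) zero = refl
  nth-swapLast (suc m) (x ∷ w) (suc j) =
    trans (nth-swapLast m w j) (cong (nth (x ∷ w)) (sym (swap-suc m (suc m) j)))

  apply-swapLast : ∀ m (w : Vec ℕ (suc (suc m))) j → apply (swapLast w) j ≡ apply w (swap m (suc m) j)
  apply-swapLast m w j with j <? suc (suc m)
  ... | yes j<2+m = begin
    apply (swapLast w) j         ≡⟨ apply-< (swapLast w) j<2+m ⟩
    nth (swapLast w) j           ≡⟨ nth-swapLast m w j ⟩
    nth w (swap m (suc m) j)     ≡⟨ apply-< w (swap-< m<2+m (n<1+n (suc m)) j<2+m) ⟨
    apply w (swap m (suc m) j)   ∎
    where
    open ≡-Reasoning
    m<2+m : m < suc (suc m)
    m<2+m = m<n⇒m<1+n (n<1+n m)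
  ... | no j≮2+m = begin
    apply (swapLast w) j         ≡⟨ apply-≮ (swapLast w) j≮2+m ⟩
    j                            ≡⟨ apply-≮ w j≮2+m ⟨
    apply w j                    ≡⟨ cong (apply w) (swap-other j≢m j≢1+m) ⟨
    apply w (swap m (suc m) j)   ∎
    where
    open ≡-Reasoning
    j≢m : j ≢ m
    j≢m refl = j≮2+m (m<n⇒m<1+n (n<1+n j))
    j≢1+m : j ≢ suc m
    j≢1+m refl = j≮2+m (n<1+n j)

  freshᵇ-swapLast : ∀ m c (w : Vec ℕ (suc (suc m))) → freshᵇ c (toList (swapLast w)) ≡ freshᵇ c (toList w)
  freshᵇ-swapLast zero c (x ∷ y ∷ []) = trans (sym (∧-assoc (not (does (c ≟ y))) _ true))
    (trans (cong (_∧ true) (∧-comm (not (does (c ≟ y))) _)) (∧-assoc (not (does (c ≟ x))) _ true))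
  freshᵇ-swapLast (suc m) c (x ∷ w) = cong (not (does (c ≟ x)) ∧_) (freshᵇ-swapLast m c w)

  distinctᵇ-swapLast : ∀ m (w : Vec ℕ (suc (suc m))) → distinctᵇ (toList (swapLast w)) ≡ distinctᵇ (toList w)
  distinctᵇ-swapLast zero (x ∷ y ∷ []) =
    cong (λ b → (not b ∧ true) ∧ true ∧ true) (does-⇔ (mk⇔ sym sym) (y ≟ x) (x ≟ y))
  distinctᵇ-swapLast (suc m) (x ∷ w) = cong₂ _∧_ (freshᵇ-swapLast m x w) (distinctᵇ-swapLast m w)

  freshᵇ-∷ʳ : ∀ x xs c → freshᵇ x (xs ++ [ c ]) ≡ freshᵇ x xs ∧ not (does (x ≟ c))
  freshᵇ-∷ʳ x [] c = ∧-comm (not (does (x ≟ c))) true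
  freshᵇ-∷ʳ x (y ∷ xs) c =
    trans (cong (not (does (x ≟ y)) ∧_) (freshᵇ-∷ʳ x xs c)) (sym (∧-assoc (not (does (x ≟ y))) _ _))

  distinctᵇ-∷ʳ : ∀ xs c → distinctᵇ (xs ++ [ c ]) ≡ distinctᵇ xs ∧ freshᵇ c xs
  distinctᵇ-∷ʳ [] c = refl
  distinctᵇ-∷ʳ (x ∷ xs) c = begin
    freshᵇ x (xs ++ [ c ]) ∧ distinctᵇ (xs ++ [ c ])
      ≡⟨ cong₂ _∧_ (freshᵇ-∷ʳ x xs c) (distinctᵇ-∷ʳ xs c) ⟩
    (freshᵇ x xs ∧ not (does (x ≟ c))) ∧ (distinctᵇ xs ∧ freshᵇ c xs)
      ≡⟨ interchange (freshᵇ x xs) _ _ _ ⟩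
    (freshᵇ x xs ∧ distinctᵇ xs) ∧ (not (does (x ≟ c)) ∧ freshᵇ c xs)
      ≡⟨ cong (λ b → (freshᵇ x xs ∧ distinctᵇ xs) ∧ (not b ∧ freshᵇ c xs))
              (does-⇔ (mk⇔ sym sym) (x ≟ c) (c ≟ x)) ⟩
    (freshᵇ x xs ∧ distinctᵇ xs) ∧ (not (does (c ≟ x)) ∧ freshᵇ c xs) ∎
    where open ≡-Reasoning

  ∑-allVecs-∷ʳ : ∀ {A : Set} k (H : Vec A (suc k) → ℤ) (L : List A) →
                 ∑ H (allVecs (suc k) L) ≡ ∑ (λ w → ∑ (λ y → H (w ∷ʳ y)) L) (allVecs k L)
  ∑-allVecs-∷ʳ zero H L =
    trans (∑-allVecs-suc H L) (trans (∑-cong L (λ x → ℤ.+-identityʳ (H (x ∷ [])))) (sym (ℤ.+-identityʳ _)))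
  ∑-allVecs-∷ʳ (suc k) H L =
    trans (∑-allVecs-suc H L)
          (trans (∑-cong L (λ x → ∑-allVecs-∷ʳ k (λ v → H (x ∷ v)) L))
                 (sym (∑-allVecs-suc (λ w → ∑ (λ y → H (w ∷ʳ y)) L) L)))

  nth-∷ʳ-last : ∀ {k} (w : Vec ℕ k) y → nth (w ∷ʳ y) k ≡ y
  nth-∷ʳ-last [] y = refl
  nth-∷ʳ-last (x ∷ w) y = nth-∷ʳ-last w y

  nth-∷ʳ-< : ∀ {k} (w : Vec ℕ k) y {j} → j < k → nth (w ∷ʳ y) j ≡ nth w j
  nth-∷ʳ-< (x ∷ w) y {zero} _ = refl
  nth-∷ʳ-< (x ∷ w) y {suc j} (s<s j<k) = nth-∷ʳ-< w y j<k

  apply-∷ʳ : ∀ {k} (w : Vec ℕ k) j → apply (w ∷ʳ k) j ≡ apply w j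
  apply-∷ʳ {k} w j with <-cmp j k
  ... | tri< j<k _ _ =
    trans (apply-< (w ∷ʳ k) (m<n⇒m<1+n j<k)) (trans (nth-∷ʳ-< w k j<k) (sym (apply-< w j<k)))
  ... | tri≈ _ refl _ =
    trans (apply-< (w ∷ʳ k) (n<1+n k)) (trans (nth-∷ʳ-last w k) (sym (apply-≮ w (<-irrefl refl))))
  ... | tri> _ _ k<j =
    trans (apply-≮ (w ∷ʳ k) (<⇒≱ k<j ∘ ≤-pred)) (sym (apply-≮ w (<⇒≯ k<j)))

  ∑-upTo-pick : ∀ K (Z : ℕ → ℤ) → ∑ (λ y → if does (y ≟ K) then Z y else + 0) (upTo (suc K)) ≡ Z K
  ∑-upTo-pick K Z = begin
    ∑ P (upTo (suc K))     ≡⟨ cong (∑ P) (upTo-∷ʳ K) ⟨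
    ∑ P (upTo K ++ [ K ])  ≡⟨ ∑-∷ʳ P (upTo K) K ⟩
    ∑ P (upTo K) ℤ.+ P K   ≡⟨ cong₂ ℤ._+_ below-K at-K ⟩
    + 0 ℤ.+ Z K            ≡⟨ ℤ.+-identityˡ (Z K) ⟩
    Z K                    ∎
    where
    open ≡-Reasoning
    P : ℕ → ℤ
    P y = if does (y ≟ K) then Z y else + 0
    at-K : P K ≡ Z K
    at-K = cong (λ b → if b then Z K else + 0) (dec-true (K ≟ K) refl)
    below-K : ∑ P (upTo K) ≡ + 0
    below-K = trans (∑-cong-∈ (upTo K) (λ y y∈ →
                      cong (λ b → if b then Z y else + 0) (dec-false (y ≟ K) (<⇒≢ (∈-upTo⁻ y∈)))))
                    (∑-zero (upTo K))

  ∑-allVecs-fresh : ∀ K k (Y : Vec ℕ k → ℤ) →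
                    ∑ (λ w → if freshᵇ K (toList w) then Y w else + 0) (allVecs k (upTo (suc K))) ≡
                    ∑ Y (allVecs k (upTo K))
  ∑-allVecs-fresh K zero Y = refl
  ∑-allVecs-fresh K (suc k) Y = begin
    ∑ P (allVecs (suc k) (upTo (suc K)))
      ≡⟨ ∑-allVecs-suc P (upTo (suc K)) ⟩
    ∑ startingWith (upTo (suc K))
      ≡⟨ cong (∑ startingWith) (upTo-∷ʳ K) ⟨
    ∑ startingWith (upTo K ++ [ K ])
      ≡⟨ ∑-∷ʳ startingWith (upTo K) K ⟩
    ∑ startingWith (upTo K) ℤ.+ startingWith K
      ≡⟨ cong₂ ℤ._+_ (∑-cong-∈ (upTo K) startingBelow-K) startingWith-K ⟩
    ∑ (λ x → ∑ (λ v → Y (x ∷ v)) (allVecs k (upTo K))) (upTo K) ℤ.+ + 0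
      ≡⟨ trans (ℤ.+-identityʳ _) (sym (∑-allVecs-suc Y (upTo K))) ⟩
    ∑ Y (allVecs (suc k) (upTo K)) ∎
    where
    open ≡-Reasoning
    P : Vec ℕ (suc k) → ℤ
    P w = if freshᵇ K (toList w) then Y w else + 0
    startingWith : ℕ → ℤ
    startingWith x = ∑ (λ v → P (x ∷ v)) (allVecs k (upTo (suc K)))
    startingWith-K : startingWith K ≡ + 0
    startingWith-K = trans (∑-cong (allVecs k (upTo (suc K))) (λ v →
                             cong (λ b → if not b ∧ freshᵇ K (toList v) then Y (K ∷ v) else + 0) (dec-true (K ≟ K) refl)))
                           (∑-zero (allVecs k (upTo (suc K))))
    startingBelow-K : ∀ x → x ∈ upTo K → startingWith x ≡ ∑ (λ v → Y (x ∷ v)) (allVecs k (upTo K))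
    startingBelow-K x x∈ =
      trans (∑-cong (allVecs k (upTo (suc K))) (λ v →
              cong (λ b → if not b ∧ freshᵇ K (toList v) then Y (x ∷ v) else + 0)
                   (dec-false (K ≟ x) (<⇒≢ (∈-upTo⁻ x∈) ∘ sym))))
            (∑-allVecs-fresh K k (λ v → Y (x ∷ v)))

module SignedExcedances where

  open import Data.Nat using (ℕ; suc; _<_; _<ᵇ_)
  import Data.Nat as ℕ
  open import Data.Nat.Properties
  open import Data.Bool using (Bool; true; false; if_then_else_; _∧_; T)
  open import Data.Bool.Properties using (T-≡; ∧-comm; if-∧)
  open import Data.List using (List; upTo)
  open import Data.Vec using (Vec; toList; _∷ʳ_)
  open import Data.Vec.Properties using (toList-∷ʳ)
  open import Data.Product using (_,_; proj₁; proj₂)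
  open import Data.Empty using (⊥; ⊥-elim)
  open import Function using (_∘_; Equivalence; mk⇔)
  open import Relation.Nullary using (yes; no; does)
  open import Relation.Nullary.Decidable using (dec-true; dec-false; does-⇔)
  open import Relation.Binary.PropositionalEquality
  open import Data.Integer using (ℤ; +_; -_; _*_; _^_; _+_; _-_)
  import Data.Integer.Properties as ℤ
  open import Data.Integer.Tactic.RingSolver using (solve-∀)
  open import Defs using (allVecs)
  open ListSum
  open Booleans
  open Permutation
  open OneLine
  open Equivalence using (from)

  excedances : ℕ → (ℕ → ℕ) → ℕ
  excedances n t = countBelow (λ j → j <ᵇ t j) n

  weight : ℕ → ℤ → (ℕ → ℕ) → ℤ
  weight n x t = x ^ excedances n t * sgn (cycles n t)

  signedExcSum : ℕ → ℤ → ℤ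
  signedExcSum n x = ∑ (λ w → if distinctᵇ (toList w) then weight n x (apply w) else + 0) (allVecs n (upTo n))

  weight-≗ : ∀ n x {t u} → (∀ j → t j ≡ u j) → weight n x t ≡ weight n x u
  weight-≗ n x t≗u = cong₂ (λ e c → x ^ e * sgn c)
                           (countBelow-cong n (λ {j} _ → cong (j <ᵇ_) (t≗u j)))
                           (cycles-≗ n t≗u)

  IsPermutation-extend : ∀ {k t} → IsPermutation k t → t k ≡ k → IsPermutation (suc k) t
  IsPermutation-extend {k} {t} (closed , inj) tk≡k = closed′ , inj′
    where
    closed′ : MapsBelow (suc k) t
    closed′ {j} j<1+k with j ≟ k
    ... | yes refl = subst (_< suc k) (sym tk≡k) (n<1+n k)
    ... | no j≢k = m<n⇒m<1+n (closed (m<1+n∧m≢n⇒m<n j<1+k j≢k))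
    inj′ : InjectiveBelow (suc k) t
    inj′ {i} {j} i< j< ti≡tj with i ≟ k | j ≟ k
    ... | yes refl | yes refl = refl
    ... | yes refl | no j≢k = ⊥-elim (<⇒≢ (closed (m<1+n∧m≢n⇒m<n j< j≢k)) (trans (sym ti≡tj) tk≡k))
    ... | no i≢k | yes refl = ⊥-elim (<⇒≢ (closed (m<1+n∧m≢n⇒m<n i< i≢k)) (trans ti≡tj tk≡k))
    ... | no i≢k | no j≢k = inj (m<1+n∧m≢n⇒m<n i< i≢k) (m<1+n∧m≢n⇒m<n j< j≢k) ti≡tj

  weight-fixedTop : ∀ {k t} x → IsPermutation k t → t k ≡ k → weight (suc k) x t ≡ - weight k x t
  weight-fixedTop {k} {t} x perm tk≡k = begin
    x ^ excedances (suc k) t * sgn (cycles (suc k) t)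
      ≡⟨ cong₂ (λ e c → x ^ e * sgn c) exc cyc ⟩
    x ^ excedances k t * sgn (1 ℕ.+ cycles k t)
      ≡⟨ cong (x ^ excedances k t *_) (ℤ.-1*i≡-i (sgn (cycles k t))) ⟩
    x ^ excedances k t * - sgn (cycles k t)
      ≡⟨ ℤ.neg-distribʳ-* (x ^ excedances k t) (sgn (cycles k t)) ⟨
    - weight k x t ∎
    where
    open ≡-Reasoning
    exc : excedances (suc k) t ≡ excedances k t
    exc = trans (countBelow-suc (λ j → j <ᵇ t j) k)
                (trans (cong (λ y → excedances k t ℕ.+ bit (k <ᵇ y)) tk≡k)
                       (trans (cong (λ b → excedances k t ℕ.+ bit b) (dec-false (k <? k) (<-irrefl refl)))
                              (+-identityʳ _)))
    cyc : cycles (suc k) t ≡ 1 ℕ.+ cycles k t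
    cyc = trans (cycles-removeTop (IsPermutation-extend perm tk≡k))
                (cong₂ (λ b c → bit b ℕ.+ c) (dec-true (t k ≟ k) tk≡k)
                       (cycles-cong (proj₁ (IsPermutation-removeTop (IsPermutation-extend perm tk≡k)))
                                    (λ j<k → removeTop-miss {t = t} (<⇒≢ (proj₁ perm j<k)))))

  -- Among the last two positions only m can be an excedance, and only by mapping to m + 1.
  excedances-lastTwo : ∀ {m t} → MapsBelow (suc (suc m)) t →
                    excedances (suc (suc m)) t ≡ excedances m t ℕ.+ bit (does (t m ≟ suc m))
  excedances-lastTwo {m} {t} closed = begin
    excedances (suc (suc m)) t
      ≡⟨ countBelow-suc (λ j → j <ᵇ t j) (suc m) ⟩
    excedances (suc m) t ℕ.+ bit (suc m <ᵇ t (suc m))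
      ≡⟨ cong₂ (λ e b → e ℕ.+ bit b) (countBelow-suc (λ j → j <ᵇ t j) m)
               (dec-false (suc m <? t (suc m)) (≤⇒≯ (≤-pred (closed (n<1+n (suc m)))))) ⟩
    excedances m t ℕ.+ bit (m <ᵇ t m) ℕ.+ 0
      ≡⟨ +-identityʳ _ ⟩
    excedances m t ℕ.+ bit (m <ᵇ t m)
      ≡⟨ cong (λ b → excedances m t ℕ.+ bit b) (does-m<-top (closed (m<n⇒m<1+n (n<1+n m)))) ⟩
    excedances m t ℕ.+ bit (does (t m ≟ suc m)) ∎
    where
    open ≡-Reasoning
    does-m<-top : ∀ {v} → v < suc (suc m) → (m <ᵇ v) ≡ does (v ≟ suc m)
    does-m<-top v<2+m =
      does-⇔ (mk⇔ (λ m<v → ≤-antisym (≤-pred v<2+m) m<v) (λ { refl → n<1+n m })) (m <? _) (_ ≟ suc m)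

  self-negating⇒0 : ∀ (z : ℤ) → z ≡ - z → z ≡ + 0
  self-negating⇒0 z z≡-z = ℤ.*-cancelˡ-≡ (+ 2) z (+ 0)
    (trans (double z) (trans (cong (_+_ z) z≡-z) (ℤ.+-inverseʳ z)))
    where
    double : ∀ z → + 2 * z ≡ z + z
    double = solve-∀

  if-split : ∀ a b (W : ℤ) → (a ≡ true → b ≡ true → W ≡ + 0) →
             W ≡ (if a then W else + 0) + ((if b then W else + 0) + (if a then + 0 else if b then + 0 else W))
  if-split true true W both⇒0 rewrite both⇒0 refl refl = refl
  if-split true false W _ = sym (ℤ.+-identityʳ W)
  if-split false true W _ = sym (trans (ℤ.+-identityˡ _) (ℤ.+-identityʳ W))
  if-split false false W _ = sym (trans (ℤ.+-identityˡ _) (ℤ.+-identityˡ W))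

  -- The involution w ↦ swapLast w (τ ↦ τ ∘ (m m+1)) reverses the sign of (-1)^cyc. It kills the words in which
  -- neither m nor m+1 is sent to m+1, and matches τ with τ(m) = m+1 to τ with τ(m+1) = m+1 up to the factor -x.
  module Recurrence (m : ℕ) (x : ℤ) where

    N : ℕ
    N = suc (suc m)

    m<N : m < N
    m<N = m<n⇒m<1+n (n<1+n m)

    fixesTop hitsTop : Vec ℕ N → Bool
    fixesTop w = does (apply w (suc m) ≟ suc m)
    hitsTop w = does (apply w m ≟ suc m)

    g gFixes gHits gRest : Vec ℕ N → ℤ
    g w = if distinctᵇ (toList w) then weight N x (apply w) else + 0
    gFixes w = if fixesTop w then g w else + 0
    gHits w = if hitsTop w then g w else + 0
    gRest w = if fixesTop w then + 0 else if hitsTop w then + 0 else g w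

    fixesTop-swapLast : ∀ w → fixesTop (swapLast w) ≡ hitsTop w
    fixesTop-swapLast w = cong (λ y → does (y ≟ suc m))
      (trans (apply-swapLast m w (suc m)) (cong (apply w) (swap-right m (suc m))))

    hitsTop-swapLast : ∀ w → hitsTop (swapLast w) ≡ fixesTop w
    hitsTop-swapLast w = cong (λ y → does (y ≟ suc m))
      (trans (apply-swapLast m w m) (cong (apply w) (swap-left m (suc m))))

    module _ (w : Vec ℕ N) (distinct : T (distinctᵇ (toList w))) (below : AllBelow N w) where

      private
        t : ℕ → ℕ
        t = apply w
        perm : IsPermutation N t
        perm = IsPermutation-apply w distinct below

      ¬fixes∧hits : fixesTop w ≡ true → hitsTop w ≡ true → ⊥
      ¬fixes∧hits fixes hits = <⇒≢ (n<1+n m) (proj₂ perm m<N (n<1+n (suc m))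
        (trans (does≡true⇒ (t m ≟ suc m) hits) (sym (does≡true⇒ (t (suc m) ≟ suc m) fixes))))

      weight-word : weight N x t ≡ x ^ (excedances m t ℕ.+ bit (hitsTop w)) * sgn (cycles N t)
      weight-word = cong (λ e → x ^ e * sgn (cycles N t)) (excedances-lastTwo (proj₁ perm))

      weight-swapLast : weight N x (apply (swapLast w)) ≡ x ^ (excedances m t ℕ.+ bit (fixesTop w)) * - sgn (cycles N t)
      weight-swapLast = begin
        weight N x (apply (swapLast w))
          ≡⟨ weight-≗ N x (apply-swapLast m w) ⟩
        x ^ excedances N u * sgn (cycles N u)
          ≡⟨ cong₂ (λ e s → x ^ e * s) exc (swap-reversesSign N perm m<N (n<1+n (suc m)) (<⇒≢ (n<1+n m))) ⟩
        x ^ (excedances m t ℕ.+ bit (fixesTop w)) * - sgn (cycles N t) ∎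
        where
        open ≡-Reasoning
        u : ℕ → ℕ
        u = t ∘ swap m (suc m)
        exc : excedances N u ≡ excedances m t ℕ.+ bit (fixesTop w)
        exc = trans (excedances-lastTwo (proj₁ (IsPermutation-∘swap perm m<N (n<1+n (suc m)))))
                    (cong₂ (λ e y → e ℕ.+ bit (does (y ≟ suc m)))
                           (countBelow-cong m (λ {j} j<m →
                              cong (j <ᵇ_) (cong t (swap-other (<⇒≢ j<m) (<⇒≢ (m<n⇒m<1+n j<m))))))
                           (cong t (swap-left m (suc m))))

    g-split : ∀ w → AllBelow N w → g w ≡ gFixes w + (gHits w + gRest w)
    g-split w below = if-split (fixesTop w) (hitsTop w) (g w) exclusive
      where
      exclusive : fixesTop w ≡ true → hitsTop w ≡ true → g w ≡ + 0
      exclusive fixes hits with distinctᵇ (toList w) in d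
      ... | true = ⊥-elim (¬fixes∧hits w (from T-≡ d) below fixes hits)
      ... | false = refl

    gRest-swapLast : ∀ w → AllBelow N w → gRest (swapLast w) ≡ - gRest w
    gRest-swapLast w below
      rewrite fixesTop-swapLast w | hitsTop-swapLast w | distinctᵇ-swapLast m w
      with hitsTop w in hits | fixesTop w in fixes
    ... | true | true = refl
    ... | true | false = refl
    ... | false | true = refl
    ... | false | false with distinctᵇ (toList w) in d
    ...   | false = refl
    ...   | true = begin
      weight N x (apply (swapLast w))
        ≡⟨ weight-swapLast w (from T-≡ d) below ⟩
      x ^ (E ℕ.+ bit (fixesTop w)) * - s
        ≡⟨ cong (λ b → x ^ (E ℕ.+ bit b) * - s) (trans fixes (sym hits)) ⟩
      x ^ (E ℕ.+ bit (hitsTop w)) * - s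
        ≡⟨ ℤ.neg-distribʳ-* (x ^ (E ℕ.+ bit (hitsTop w))) s ⟨
      - (x ^ (E ℕ.+ bit (hitsTop w)) * s)
        ≡⟨ cong -_ (weight-word w (from T-≡ d) below) ⟨
      - weight N x (apply w) ∎
      where
      open ≡-Reasoning
      E : ℕ
      E = excedances m (apply w)
      s : ℤ
      s = sgn (cycles N (apply w))

    gHits-swapLast : ∀ w → AllBelow N w → gHits (swapLast w) ≡ - x * gFixes w
    gHits-swapLast w below
      rewrite hitsTop-swapLast w | distinctᵇ-swapLast m w
      with fixesTop w in fixes
    ... | false = sym (ℤ.*-zeroʳ (- x))
    ... | true with distinctᵇ (toList w) in d
    ...   | false = sym (ℤ.*-zeroʳ (- x))
    ...   | true = begin
      weight N x (apply (swapLast w))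
        ≡⟨ weight-swapLast w (from T-≡ d) below ⟩
      x ^ (E ℕ.+ bit (fixesTop w)) * - s
        ≡⟨ cong (λ b → x ^ (E ℕ.+ bit b) * - s) fixes ⟩
      x ^ (E ℕ.+ 1) * - s
        ≡⟨ cong (λ e → x ^ e * - s) (+-comm E 1) ⟩
      x * x ^ E * - s
        ≡⟨ reassociate x (x ^ E) s ⟩
      - x * (x ^ E * s)
        ≡⟨ cong (λ e → - x * (x ^ e * s)) (+-identityʳ E) ⟨
      - x * (x ^ (E ℕ.+ 0) * s)
        ≡⟨ cong (λ b → - x * (x ^ (E ℕ.+ bit b) * s)) ¬hits ⟨
      - x * (x ^ (E ℕ.+ bit (hitsTop w)) * s)
        ≡⟨ cong (- x *_) (weight-word w (from T-≡ d) below) ⟨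
      - x * weight N x (apply w) ∎
      where
      open ≡-Reasoning
      E : ℕ
      E = excedances m (apply w)
      s : ℤ
      s = sgn (cycles N (apply w))
      reassociate : ∀ x a s → x * a * - s ≡ - x * (a * s)
      reassociate = solve-∀
      ¬hits : hitsTop w ≡ false
      ¬hits with hitsTop w in hits
      ... | true = ⊥-elim (¬fixes∧hits w (from T-≡ d) below fixes hits)
      ... | false = refl

    Words : List (Vec ℕ N)
    Words = allVecs N (upTo N)

    ∑gRest≡0 : ∑ gRest Words ≡ + 0
    ∑gRest≡0 = self-negating⇒0 _
      (trans (∑-allVecs-swapLast m gRest (upTo N)) (trans (∑-allVecs-cong N N gRest-swapLast) (∑-neg gRest Words)))

    ∑gHits : ∑ gHits Words ≡ - x * ∑ gFixes Words
    ∑gHits = trans (∑-allVecs-swapLast m gHits (upTo N))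
                   (trans (∑-allVecs-cong N N gHits-swapLast) (∑-*ˡ (- x) gFixes Words))

    ∑gFixes : ∑ gFixes Words ≡ - signedExcSum (suc m) x
    ∑gFixes = begin
      ∑ gFixes Words
        ≡⟨ ∑-allVecs-∷ʳ (suc m) gFixes (upTo N) ⟩
      ∑ (λ v → ∑ (λ y → gFixes (v ∷ʳ y)) (upTo N)) (allVecs (suc m) (upTo N))
        ≡⟨ ∑-cong (allVecs (suc m) (upTo N)) last-is-top ⟩
      ∑ (λ v → g (v ∷ʳ suc m)) (allVecs (suc m) (upTo N))
        ≡⟨ ∑-cong (allVecs (suc m) (upTo N)) g-∷ʳ-top ⟩
      ∑ (λ v → if freshᵇ (suc m) (toList v) then gLong v else + 0) (allVecs (suc m) (upTo N))
        ≡⟨ ∑-allVecs-fresh (suc m) (suc m) gLong ⟩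
      ∑ gLong (allVecs (suc m) (upTo (suc m)))
        ≡⟨ ∑-allVecs-cong (suc m) (suc m) gLong-fixedTop ⟩
      ∑ (λ v → - gShort v) (allVecs (suc m) (upTo (suc m)))
        ≡⟨ ∑-neg gShort (allVecs (suc m) (upTo (suc m))) ⟩
      - signedExcSum (suc m) x ∎
      where
      open ≡-Reasoning
      gLong gShort : Vec ℕ (suc m) → ℤ
      gLong v = if distinctᵇ (toList v) then weight N x (apply v) else + 0
      gShort v = if distinctᵇ (toList v) then weight (suc m) x (apply v) else + 0

      last-is-top : ∀ v → ∑ (λ y → gFixes (v ∷ʳ y)) (upTo N) ≡ g (v ∷ʳ suc m)
      last-is-top v = trans
        (∑-cong (upTo N) (λ y → cong (λ z → if does (z ≟ suc m) then g (v ∷ʳ y) else + 0)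
                                     (trans (apply-< (v ∷ʳ y) (n<1+n (suc m))) (nth-∷ʳ-last v y))))
        (∑-upTo-pick (suc m) (λ y → g (v ∷ʳ y)))

      g-∷ʳ-top : ∀ v → g (v ∷ʳ suc m) ≡ (if freshᵇ (suc m) (toList v) then gLong v else + 0)
      g-∷ʳ-top v = begin
        g (v ∷ʳ suc m)
          ≡⟨ cong₂ (λ b W → if b then W else + 0)
                   (trans (cong distinctᵇ (toList-∷ʳ (suc m) v)) (distinctᵇ-∷ʳ (toList v) (suc m)))
                   (weight-≗ N x (apply-∷ʳ v)) ⟩
        (if distinctᵇ (toList v) ∧ freshᵇ (suc m) (toList v) then weight N x (apply v) else + 0)
          ≡⟨ cong (λ b → if b then weight N x (apply v) else + 0) (∧-comm (distinctᵇ (toList v)) _) ⟩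
        (if freshᵇ (suc m) (toList v) ∧ distinctᵇ (toList v) then weight N x (apply v) else + 0)
          ≡⟨ if-∧ (freshᵇ (suc m) (toList v)) ⟩
        (if freshᵇ (suc m) (toList v) then gLong v else + 0) ∎

      gLong-fixedTop : ∀ v → AllBelow (suc m) v → gLong v ≡ - gShort v
      gLong-fixedTop v below with distinctᵇ (toList v) in d
      ... | true = weight-fixedTop x (IsPermutation-apply v (from T-≡ d) below) (apply-≮ v (<-irrefl refl))
      ... | false = refl

    recurrence : signedExcSum N x ≡ (x - + 1) * signedExcSum (suc m) x
    recurrence = begin
      ∑ g Words
        ≡⟨ ∑-allVecs-cong N N g-split ⟩
      ∑ (λ w → gFixes w + (gHits w + gRest w)) Words
        ≡⟨ trans (∑-distrib-+ gFixes _ Words) (cong (_+_ (∑ gFixes Words)) (∑-distrib-+ gHits gRest Words)) ⟩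
      ∑ gFixes Words + (∑ gHits Words + ∑ gRest Words)
        ≡⟨ cong₂ (λ a b → ∑ gFixes Words + (a + b)) ∑gHits ∑gRest≡0 ⟩
      ∑ gFixes Words + (- x * ∑ gFixes Words + + 0)
        ≡⟨ cong (λ a → a + (- x * a + + 0)) ∑gFixes ⟩
      - E + (- x * - E + + 0)
        ≡⟨ collect x E ⟩
      (x - + 1) * E ∎
      where
      open ≡-Reasoning
      E : ℤ
      E = signedExcSum (suc m) x
      collect : ∀ x e → - e + (- x * - e + + 0) ≡ (x - + 1) * e
      collect = solve-∀

module Colours where

  open import Data.Nat using (ℕ; zero; suc; _<_; _<ᵇ_; _∸_)
  import Data.Nat as ℕ
  import Data.Nat.Properties as ℕ
  open import Data.Fin using (Fin; toℕ; zero; suc)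
  import Data.Fin.Properties as Fin
  open import Data.Bool using (Bool; true; false; if_then_else_; _∧_; T)
  open import Data.Bool.Properties using (∧-zeroʳ)
  open import Data.List using (List; _∷_; map; concatMap; foldr; tabulate; allFin)
  open import Data.Vec using (Vec; _∷_; lookup; toList)
  open import Data.Product using (_,_)
  open import Function using (_∘_)
  open import Relation.Nullary.Decidable using (T?; dec-true)
  open import Relation.Binary.PropositionalEquality
  open import Data.Integer using (ℤ; _+_; _*_; +_; -_; _^_; _-_)
  open import Data.Integer.Properties
  open import Data.Integer.Tactic.RingSolver using (solve-∀)
  open import Defs
  open ListSum
  open Booleans using (bit)
  open OneLine using (∑-allVecs-suc)

  countFin : (n : ℕ) → (Fin n → Bool) → ℕ
  countFin zero p = 0
  countFin (suc n) p = bit (p zero) ℕ.+ countFin n (p ∘ suc)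

  countFin-cong : ∀ n {p p′ : Fin n → Bool} → (∀ i → p i ≡ p′ i) → countFin n p ≡ countFin n p′
  countFin-cong zero p≗p′ = refl
  countFin-cong (suc n) p≗p′ = cong₂ ℕ._+_ (cong bit (p≗p′ zero)) (countFin-cong n (p≗p′ ∘ suc))

  countB-∷ : ∀ {A : Set} (p : A → Bool) x xs → countB p (x ∷ xs) ≡ bit (p x) ℕ.+ countB p xs
  countB-∷ p x xs with p x
  ... | true = refl
  ... | false = refl

  countB-tabulate : ∀ {A : Set} n (p : A → Bool) (f : Fin n → A) → countB p (tabulate f) ≡ countFin n (p ∘ f)
  countB-tabulate zero p f = refl
  countB-tabulate (suc n) p f =
    trans (countB-∷ p (f zero) _) (cong (bit (p (f zero)) ℕ.+_) (countB-tabulate n p (f ∘ suc)))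

  colourSum : ∀ {n} → Vec (Fin 2) n → ℕ
  colourSum z = foldr (λ c acc → toℕ c ℕ.+ acc) 0 (toList z)

  -- At a position that is an excedance exactly when b holds, colour 0 contributes (q²)^[b] and colour 1
  -- contributes y; with y² = q² their sum is (1 + y) y^[b].
  colourSum-factor : ∀ q y → y * y ≡ q * q → ∀ b → (q * q) ^ bit b + y ≡ (+ 1 + y) * y ^ bit b
  colourSum-factor q y y²≡q² false = oneStep y
    where
    oneStep : ∀ y → + 1 + y ≡ (+ 1 + y) * + 1
    oneStep = solve-∀
  colourSum-factor q y y²≡q² true = trans (cong (λ s → s * + 1 + y) (sym y²≡q²)) (square y)
    where
    square : ∀ y → y * y * + 1 + y ≡ (+ 1 + y) * (y * + 1)
    square = solve-∀

  zeroColourCount : ∀ {n} → Vec (Fin 2) n → (Fin n → Bool) → ℕ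
  zeroColourCount {n} z e = countFin n (λ i → isZero (lookup z i) ∧ e i)

  ∑-colours : ∀ q y → y * y ≡ q * q → ∀ n (e : Fin n → Bool) →
              ∑ (λ z → (q * q) ^ zeroColourCount z e * y ^ colourSum z) (colours n) ≡
              (+ 1 + y) ^ n * y ^ countFin n e
  ∑-colours q y y²≡q² zero e = refl
  ∑-colours q y y²≡q² (suc n) e = begin
    ∑ f (colours (suc n))
      ≡⟨ ∑-allVecs-suc f (allFin 2) ⟩
    ∑ (λ v → f (zero ∷ v)) V + (∑ (λ v → f (suc zero ∷ v)) V + + 0)
      ≡⟨ cong₂ (λ a b → a + (b + + 0)) (trans (∑-cong V colour0) (∑-*ˡ Q f′ V))
                                        (trans (∑-cong V colour1) (∑-*ˡ y f′ V)) ⟩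
    Q * ∑ f′ V + (y * ∑ f′ V + + 0)
      ≡⟨ distribute Q y (∑ f′ V) ⟩
    (Q + y) * ∑ f′ V
      ≡⟨ cong₂ _*_ (colourSum-factor q y y²≡q² (e zero)) (∑-colours q y y²≡q² n (e ∘ suc)) ⟩
    (+ 1 + y) * y ^ bit (e zero) * ((+ 1 + y) ^ n * y ^ countFin n (e ∘ suc))
      ≡⟨ regroup (+ 1 + y) (y ^ bit (e zero)) ((+ 1 + y) ^ n) (y ^ countFin n (e ∘ suc)) ⟩
    (+ 1 + y) * (+ 1 + y) ^ n * (y ^ bit (e zero) * y ^ countFin n (e ∘ suc))
      ≡⟨ cong ((+ 1 + y) * (+ 1 + y) ^ n *_) (^-distribˡ-+-* y (bit (e zero)) _) ⟨
    (+ 1 + y) ^ suc n * y ^ countFin (suc n) e ∎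
    where
    open ≡-Reasoning
    V : List (Vec (Fin 2) n)
    V = colours n
    Q : ℤ
    Q = (q * q) ^ bit (e zero)
    f : Vec (Fin 2) (suc n) → ℤ
    f z = (q * q) ^ zeroColourCount z e * y ^ colourSum z
    f′ : Vec (Fin 2) n → ℤ
    f′ v = (q * q) ^ zeroColourCount v (e ∘ suc) * y ^ colourSum v
    colour0 : ∀ v → f (zero ∷ v) ≡ Q * f′ v
    colour0 v = trans (cong (_* y ^ colourSum v) (^-distribˡ-+-* (q * q) (bit (e zero)) (zeroColourCount v (e ∘ suc))))
                      (*-assoc Q _ _)
    colour1 : ∀ v → f (suc zero ∷ v) ≡ y * f′ v
    colour1 v = swapFactor ((q * q) ^ zeroColourCount v (e ∘ suc)) y (y ^ colourSum v)
      where
      swapFactor : ∀ a y c → a * (y * c) ≡ y * (a * c)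
      swapFactor = solve-∀
    distribute : ∀ a b c → a * c + (b * c + + 0) ≡ (a + b) * c
    distribute = solve-∀
    regroup : ∀ a b c d → a * b * (c * d) ≡ a * c * (b * d)
    regroup = solve-∀

  neg-^ : ∀ q c → (- q) ^ c ≡ (if isEven c then q ^ c else - (q ^ c))
  neg-^ q zero = refl
  neg-^ q (suc zero) = sym (neg-distribˡ-* q (+ 1))
  neg-^ q (suc (suc c)) with isEven c | neg-^ q c
  ... | true | ih = trans (cong (λ v → - q * (- q * v)) ih) (evenStep q (q ^ c))
    where
    evenStep : ∀ q v → - q * (- q * v) ≡ q * (q * v)
    evenStep = solve-∀
  ... | false | ih = trans (cong (λ v → - q * (- q * v)) ih) (oddStep q (q ^ c))
    where
    oddStep : ∀ q v → - q * (- q * - v) ≡ - (q * (q * v))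
    oddStep = solve-∀

  twice-ifEven : ∀ (A q S : ℤ) c → + 2 * (if isEven c then A * q ^ c * S else + 0) ≡ S * (A * q ^ c + A * (- q) ^ c)
  twice-ifEven A q S c with isEven c | neg-^ q c
  ... | true | neg-q^c = trans (even A (q ^ c) S) (cong (λ v → S * (A * q ^ c + A * v)) (sym neg-q^c))
    where
    even : ∀ a b s → + 2 * (a * b * s) ≡ s * (a * b + a * b)
    even = solve-∀
  ... | false | neg-q^c = trans (odd A (q ^ c) S) (cong (λ v → S * (A * q ^ c + A * v)) (sym neg-q^c))
    where
    odd : ∀ a b s → + 2 * + 0 ≡ s * (a * b + a * - b)
    odd = solve-∀

  excedanceᶠ : ∀ {n} → Vec (Fin n) n → Fin n → Bool
  excedanceᶠ τ i = toℕ i <ᵇ toℕ (lookup τ i)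

  excA≡zeroColourCount : ∀ {n} (z : Vec (Fin 2) n) (τ : Vec (Fin n) n) →
                         excA (z , τ) ≡ zeroColourCount z (excedanceᶠ τ)
  excA≡zeroColourCount {n} z τ =
    trans (countB-tabulate n _ (λ i → i))
          (countFin-cong n (λ i → redundant-bound i (lookup τ i) (isZero (lookup z i))))
    where
    redundant-bound : (i j : Fin n) (b : Bool) →
                      ((toℕ i <ᵇ n ∸ 1) ∧ b ∧ (toℕ i <ᵇ toℕ j)) ≡ b ∧ (toℕ i <ᵇ toℕ j)
    redundant-bound i j b with toℕ i <ᵇ toℕ j in i<ᵇj
    ... | false = trans (cong ((toℕ i <ᵇ n ∸ 1) ∧_) (∧-zeroʳ b)) (trans (∧-zeroʳ _) (sym (∧-zeroʳ b)))
    ... | true = cong (_∧ (b ∧ true)) (dec-true (toℕ i ℕ.<? n ∸ 1) i<n∸1)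
      where
      i<n∸1 : toℕ i < n ∸ 1
      i<n∸1 = ℕ.<-≤-trans (ℕ.<ᵇ⇒< (toℕ i) (toℕ j) (subst T (sym i<ᵇj) _)) (ℕ.<⇒≤pred (Fin.toℕ<n j))

  excᶠ cycᶠ : ∀ {n} → Vec (Fin n) n → ℕ
  excᶠ {n} τ = countB (excedanceᶠ τ) (allFin n)
  cycᶠ {n} τ = countB (isCycleMin τ) (allFin n)

  signedExcSumᶠ : ℕ → ℤ → ℤ
  signedExcSumᶠ n x =
    ∑ (λ τ → x ^ excᶠ τ * (- + 1) ^ cycᶠ τ) (perms n)

  summand : ∀ {n} → ℤ → B n → ℤ
  summand q σ = q ^ excClr σ * (+ 1) ^ fix σ * (- + 1) ^ cyc σ

  evenSummand : ∀ {n} → ℤ → Vec (Fin 2) n → Vec (Fin n) n → ℤ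
  evenSummand q z τ = if isEven (csum (z , τ)) then summand q (z , τ) else + 0

  twice-∑-evenColours : ∀ q {n} (τ : Vec (Fin n) n) →
    + 2 * ∑ (λ z → evenSummand q z τ) (colours n) ≡
    (- + 1) ^ cycᶠ τ *
      ((+ 1 + q) ^ n * q ^ excᶠ τ + (+ 1 - q) ^ n * (- q) ^ excᶠ τ)
  twice-∑-evenColours q {n} τ = begin
    + 2 * ∑ (λ z → evenSummand q z τ) C
      ≡⟨ ∑-*ˡ (+ 2) (λ z → evenSummand q z τ) C ⟨
    ∑ (λ z → + 2 * evenSummand q z τ) C
      ≡⟨ ∑-cong C twice-evenSummand ⟩
    ∑ (λ z → S * (G q z + G (- q) z)) C
      ≡⟨ trans (∑-*ˡ S _ C) (cong (S *_) (∑-distrib-+ (G q) (G (- q)) C)) ⟩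
    S * (∑ (G q) C + ∑ (G (- q)) C)
      ≡⟨ cong (S *_) (cong₂ _+_ (∑-colours q q refl n e) (∑-colours q (- q) (neg-square q) n e)) ⟩
    S * ((+ 1 + q) ^ n * q ^ countFin n e + (+ 1 - q) ^ n * (- q) ^ countFin n e)
      ≡⟨ cong (λ k → S * ((+ 1 + q) ^ n * q ^ k + (+ 1 - q) ^ n * (- q) ^ k)) (countB-tabulate n e (λ i → i)) ⟨
    S * ((+ 1 + q) ^ n * q ^ countB e (allFin n) + (+ 1 - q) ^ n * (- q) ^ countB e (allFin n)) ∎
    where
    open ≡-Reasoning
    C : List (Vec (Fin 2) n)
    C = colours n
    S : ℤ
    S = (- + 1) ^ cycᶠ τ
    e : Fin n → Bool
    e = excedanceᶠ τ
    G : ℤ → Vec (Fin 2) n → ℤ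
    G y z = (q * q) ^ zeroColourCount z e * y ^ colourSum z
    neg-square : ∀ q → - q * - q ≡ q * q
    neg-square = solve-∀
    summand≡ : ∀ z → summand q (z , τ) ≡ (q * q) ^ zeroColourCount z e * q ^ colourSum z * S
    summand≡ z = cong (_* S) (begin
      q ^ (2 ℕ.* excA (z , τ) ℕ.+ colourSum z) * (+ 1) ^ fix (z , τ)
        ≡⟨ trans (cong (q ^ (2 ℕ.* excA (z , τ) ℕ.+ colourSum z) *_) (^-zeroˡ (fix (z , τ)))) (*-identityʳ _) ⟩
      q ^ (2 ℕ.* excA (z , τ) ℕ.+ colourSum z)
        ≡⟨ ^-distribˡ-+-* q (2 ℕ.* excA (z , τ)) (colourSum z) ⟩
      q ^ (2 ℕ.* excA (z , τ)) * q ^ colourSum z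
        ≡⟨ cong (_* q ^ colourSum z) (^-*-assoc q 2 (excA (z , τ))) ⟨
      (q ^ 2) ^ excA (z , τ) * q ^ colourSum z
        ≡⟨ cong₂ (λ b k → b ^ k * q ^ colourSum z) (cong (q *_) (*-identityʳ q)) (excA≡zeroColourCount z τ) ⟩
      (q * q) ^ zeroColourCount z e * q ^ colourSum z ∎)
    twice-evenSummand : ∀ z → + 2 * evenSummand q z τ ≡ S * (G q z + G (- q) z)
    twice-evenSummand z = trans (cong (λ v → + 2 * (if isEven (colourSum z) then v else + 0)) (summand≡ z))
                                (twice-ifEven ((q * q) ^ zeroColourCount z e) q S (colourSum z))

  twice-PClrD : ∀ n q → + 2 * PClrD n q (+ 1) (- + 1) ≡
                        (+ 1 + q) ^ n * signedExcSumᶠ n q + (+ 1 - q) ^ n * signedExcSumᶠ n (- q)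
  twice-PClrD n q = begin
    + 2 * ∑ (summand q) (Dn n)
      ≡⟨ cong (+ 2 *_) (∑-filter (λ σ → T? (isEven (csum σ))) (summand q) pairs) ⟩
    + 2 * ∑ (λ σ → if isEven (csum σ) then summand q σ else + 0) pairs
      ≡⟨ cong (+ 2 *_) (trans (∑-concatMap _ (λ z → map (z ,_) (perms n)) (colours n))
                              (∑-cong (colours n) (λ z → ∑-map _ (z ,_) (perms n)))) ⟩
    + 2 * ∑ (λ z → ∑ (evenSummand q z) (perms n)) (colours n)
      ≡⟨ cong (+ 2 *_) (∑-comm (evenSummand q) (colours n) (perms n)) ⟩
    + 2 * ∑ (λ τ → ∑ (λ z → evenSummand q z τ) (colours n)) (perms n)
      ≡⟨ ∑-*ˡ (+ 2) _ (perms n) ⟨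
    ∑ (λ τ → + 2 * ∑ (λ z → evenSummand q z τ) (colours n)) (perms n)
      ≡⟨ ∑-cong (perms n) (λ τ → trans (twice-∑-evenColours q τ)
                                       (spread (sign τ) ((+ 1 + q) ^ n) (power q τ) ((+ 1 - q) ^ n) (power (- q) τ))) ⟩
    ∑ (λ τ → (+ 1 + q) ^ n * term q τ + (+ 1 - q) ^ n * term (- q) τ) (perms n)
      ≡⟨ trans (∑-distrib-+ _ _ (perms n))
               (cong₂ _+_ (∑-*ˡ ((+ 1 + q) ^ n) (term q) (perms n))
                          (∑-*ˡ ((+ 1 - q) ^ n) (term (- q)) (perms n))) ⟩
    (+ 1 + q) ^ n * signedExcSumᶠ n q + (+ 1 - q) ^ n * signedExcSumᶠ n (- q) ∎
    where
    open ≡-Reasoning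
    pairs : List (B n)
    pairs = concatMap (λ z → map (z ,_) (perms n)) (colours n)
    sign : Vec (Fin n) n → ℤ
    sign τ = (- + 1) ^ cycᶠ τ
    power : ℤ → Vec (Fin n) n → ℤ
    power x τ = x ^ excᶠ τ
    term : ℤ → Vec (Fin n) n → ℤ
    term x τ = power x τ * sign τ
    spread : ∀ s a b c d → s * (a * b + c * d) ≡ a * (b * s) + c * (d * s)
    spread = solve-∀

module FinEncoding where

  open import Data.Nat using (ℕ; zero; suc; _≤ᵇ_; _<ᵇ_; _≟_)
  open import Data.Fin using (Fin; toℕ; zero; suc)
  import Data.Fin.Properties as Fin
  open import Data.Bool using (Bool; if_then_else_; not; T)
  open import Data.Bool.Properties using (T-∧)
  open import Data.List using (List; []; _∷_; map; tabulate; allFin; upTo; applyUpTo)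
  open import Data.List.Properties using (map-tabulate)
  open import Data.List.Relation.Unary.All using (All; []; _∷_)
  open import Data.List.Relation.Unary.AllPairs using ([]; _∷_)
  open import Data.List.Relation.Unary.Unique.Propositional using (Unique)
  import Data.List.Relation.Unary.Unique.DecPropositional as UniqueDec
  open import Data.Vec using (Vec; []; _∷_; lookup; toList)
  import Data.Vec as Vec
  open import Data.Vec.Properties using (toList-map)
  open import Data.Product using (_,_; proj₁; proj₂)
  open import Function using (_∘_; id; Equivalence; mk⇔)
  open import Relation.Nullary using (Dec; does)
  open import Relation.Nullary.Decidable using (T?; does-⇔)
  open import Relation.Binary.PropositionalEquality
  open import Data.Integer using (ℤ; +_; -_; _*_; _^_)
  open import Defs
  open ListSum
  open Booleans
  open Permutation
  open OneLine
  open SignedExcedances using (excedances; weight; signedExcSum)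
  open Colours using (countFin; countFin-cong; countB-tabulate; excedanceᶠ; excᶠ; cycᶠ; signedExcSumᶠ)
  open Equivalence using (to; from)

  tabulate-toℕ : ∀ {A : Set} n (f : ℕ → A) → tabulate {n = n} (f ∘ toℕ) ≡ applyUpTo f n
  tabulate-toℕ zero f = refl
  tabulate-toℕ (suc n) f = cong (f 0 ∷_) (tabulate-toℕ n (f ∘ suc))

  map-toℕ-allFin : ∀ n → map toℕ (allFin n) ≡ upTo n
  map-toℕ-allFin n = trans (map-tabulate id toℕ) (tabulate-toℕ n id)

  countFin-toℕ : ∀ n (p : ℕ → Bool) → countFin n (p ∘ toℕ) ≡ countBelow p n
  countFin-toℕ zero p = refl
  countFin-toℕ (suc n) p = cong (bit (p 0) Data.Nat.+_) (countFin-toℕ n (p ∘ suc))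

  toℕ-lookup : ∀ {n} (τ : Vec (Fin n) n) (i : Fin n) → toℕ (lookup τ i) ≡ apply (Vec.map toℕ τ) (toℕ i)
  toℕ-lookup τ i = trans (nth-map τ i) (sym (apply-< (Vec.map toℕ τ) (Fin.toℕ<n i)))
    where
    nth-map : ∀ {k n} (v : Vec (Fin n) k) (i : Fin k) → toℕ (lookup v i) ≡ nth (Vec.map toℕ v) (toℕ i)
    nth-map (x ∷ v) zero = refl
    nth-map (x ∷ v) (suc i) = nth-map v i

  toℕ-iter : ∀ {n} (τ : Vec (Fin n) n) k (i : Fin n) →
             toℕ (iter τ k i) ≡ iterate (apply (Vec.map toℕ τ)) k (toℕ i)
  toℕ-iter τ zero i = refl
  toℕ-iter τ (suc k) i = trans (toℕ-lookup τ (iter τ k i)) (cong (apply (Vec.map toℕ τ)) (toℕ-iter τ k i))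

  excedances-toℕ : ∀ {n} (τ : Vec (Fin n) n) →
                   excᶠ τ ≡ excedances n (apply (Vec.map toℕ τ))
  excedances-toℕ {n} τ = trans (countB-tabulate n (excedanceᶠ τ) id)
    (trans (countFin-cong n (λ i → cong (toℕ i <ᵇ_) (toℕ-lookup τ i)))
           (countFin-toℕ n (λ j → j <ᵇ apply (Vec.map toℕ τ) j)))

  cycles-toℕ : ∀ {n} (τ : Vec (Fin n) n) → cycᶠ τ ≡ cycles n (apply (Vec.map toℕ τ))
  cycles-toℕ {n} τ = trans (countB-tabulate n (isCycleMin τ) id)
    (trans (countFin-cong n (λ i → allB-cong (upTo (suc n)) (λ k → cong (toℕ i ≤ᵇ_) (toℕ-iter τ k i))))
           (countFin-toℕ n (isCycleMinᵇ n (apply (Vec.map toℕ τ)))))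

  freshᵇ⇒All≢ : ∀ {k} (x : Fin k) xs → T (freshᵇ (toℕ x) (map toℕ xs)) → All (x ≢_) xs
  freshᵇ⇒All≢ x [] _ = []
  freshᵇ⇒All≢ x (y ∷ ys) fresh =
    T-not-does⇒¬ (toℕ x ≟ toℕ y) (proj₁ (to T-∧ fresh)) ∘ cong toℕ ∷
    freshᵇ⇒All≢ x ys (proj₂ (to (T-∧ {not (does (toℕ x ≟ toℕ y))}) fresh))

  All≢⇒freshᵇ : ∀ {k} (x : Fin k) xs → All (x ≢_) xs → T (freshᵇ (toℕ x) (map toℕ xs))
  All≢⇒freshᵇ x [] [] = _
  All≢⇒freshᵇ x (y ∷ ys) (x≢y ∷ x∉ys) =
    from T-∧ (¬⇒T-not-does (toℕ x ≟ toℕ y) (x≢y ∘ Fin.toℕ-injective) , All≢⇒freshᵇ x ys x∉ys)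

  distinctᵇ⇒Unique : ∀ {k} (xs : List (Fin k)) → T (distinctᵇ (map toℕ xs)) → Unique xs
  distinctᵇ⇒Unique [] _ = []
  distinctᵇ⇒Unique (x ∷ xs) distinct =
    freshᵇ⇒All≢ x xs (proj₁ (to T-∧ distinct)) ∷
    distinctᵇ⇒Unique xs (proj₂ (to (T-∧ {freshᵇ (toℕ x) (map toℕ xs)}) distinct))

  Unique⇒distinctᵇ : ∀ {k} (xs : List (Fin k)) → Unique xs → T (distinctᵇ (map toℕ xs))
  Unique⇒distinctᵇ [] [] = _
  Unique⇒distinctᵇ (x ∷ xs) (x∉xs ∷ unique) =
    from T-∧ (All≢⇒freshᵇ x xs x∉xs , Unique⇒distinctᵇ xs unique)

  unique?≡distinctᵇ : ∀ {k} (xs : List (Fin k)) →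
                      does (UniqueDec.unique? Fin._≟_ xs) ≡ distinctᵇ (map toℕ xs)
  unique?≡distinctᵇ xs =
    does-⇔ (mk⇔ (Unique⇒distinctᵇ xs) (distinctᵇ⇒Unique xs)) (UniqueDec.unique? Fin._≟_ xs) (T? _)

  ∑-allVecs-map : ∀ {A : Set} n (f : A → ℕ) (G : Vec ℕ n → ℤ) (xs : List A) →
                  ∑ (G ∘ Vec.map f) (allVecs n xs) ≡ ∑ G (allVecs n (map f xs))
  ∑-allVecs-map zero f G xs = refl
  ∑-allVecs-map (suc n) f G xs = begin
    ∑ (G ∘ Vec.map f) (allVecs (suc n) xs)
      ≡⟨ ∑-allVecs-suc (G ∘ Vec.map f) xs ⟩
    ∑ (λ x → ∑ (λ v → G (f x ∷ Vec.map f v)) (allVecs n xs)) xs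
      ≡⟨ ∑-cong xs (λ x → ∑-allVecs-map n f (λ w → G (f x ∷ w)) xs) ⟩
    ∑ (λ x → ∑ (λ w → G (f x ∷ w)) (allVecs n (map f xs))) xs
      ≡⟨ ∑-map (λ y → ∑ (λ w → G (y ∷ w)) (allVecs n (map f xs))) f xs ⟨
    ∑ (λ y → ∑ (λ w → G (y ∷ w)) (allVecs n (map f xs))) (map f xs)
      ≡⟨ ∑-allVecs-suc G (map f xs) ⟨
    ∑ G (allVecs (suc n) (map f xs)) ∎
    where open ≡-Reasoning

  signedExcSumᶠ≡signedExcSum : ∀ n x → signedExcSumᶠ n x ≡ signedExcSum n x
  signedExcSumᶠ≡signedExcSum n x = begin
    ∑ term (perms n)
      ≡⟨ ∑-filter unique? term (allVecs n (allFin n)) ⟩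
    ∑ (λ τ → if does (unique? τ) then term τ else + 0) (allVecs n (allFin n))
      ≡⟨ ∑-cong (allVecs n (allFin n)) encode ⟩
    ∑ (G ∘ Vec.map toℕ) (allVecs n (allFin n))
      ≡⟨ ∑-allVecs-map n toℕ G (allFin n) ⟩
    ∑ G (allVecs n (map toℕ (allFin n)))
      ≡⟨ cong (λ L → ∑ G (allVecs n L)) (map-toℕ-allFin n) ⟩
    signedExcSum n x ∎
    where
    open ≡-Reasoning
    unique? : (τ : Vec (Fin n) n) → Dec (Unique (toList τ))
    unique? τ = UniqueDec.unique? Fin._≟_ (toList τ)
    term : Vec (Fin n) n → ℤ
    term τ = x ^ excᶠ τ * (- + 1) ^ cycᶠ τ
    G : Vec ℕ n → ℤ
    G w = if distinctᵇ (toList w) then weight n x (apply w) else + 0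
    encode : ∀ τ → (if does (unique? τ) then term τ else + 0) ≡ G (Vec.map toℕ τ)
    encode τ = cong₂ (λ b W → if b then W else + 0)
      (trans (unique?≡distinctᵇ (toList τ)) (cong distinctᵇ (sym (toList-map toℕ τ))))
      (cong₂ (λ e c → x ^ e * (- + 1) ^ c) (excedances-toℕ τ) (cycles-toℕ τ))

module ClosedForm where

  open import Data.Nat using (zero; suc)
  open import Data.Integer using (_+_; _-_; _*_; _^_; -_; +_)
  open import Data.Integer.Properties using (*-assoc; *-identityʳ; *-cancelˡ-≡)
  open import Data.Integer.Tactic.RingSolver using (solve-∀)
  open import Relation.Binary.PropositionalEquality
  open import Defs using (PClrD)
  open SignedExcedances using (signedExcSum; module Recurrence)
  open Colours using (twice-PClrD; signedExcSumᶠ)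
  open FinEncoding using (signedExcSumᶠ≡signedExcSum)

  signedExcSum-closedForm : ∀ m x → signedExcSum (suc m) x ≡ - (x - + 1) ^ m
  signedExcSum-closedForm zero x = refl
  signedExcSum-closedForm (suc m) x = begin
    signedExcSum (suc (suc m)) x       ≡⟨ Recurrence.recurrence m x ⟩
    (x - + 1) * signedExcSum (suc m) x ≡⟨ cong ((x - + 1) *_) (signedExcSum-closedForm m x) ⟩
    (x - + 1) * - (x - + 1) ^ m        ≡⟨ neg-distribʳ (x - + 1) ((x - + 1) ^ m) ⟩
    - (x - + 1) ^ suc m                ∎
    where
    open ≡-Reasoning
    neg-distribʳ : ∀ a b → a * - b ≡ - (a * b)
    neg-distribʳ = solve-∀

  ^-distrib-* : ∀ a b n → (a * b) ^ n ≡ a ^ n * b ^ n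
  ^-distrib-* a b zero = refl
  ^-distrib-* a b (suc n) = trans (cong (a * b *_) (^-distrib-* a b n)) (interchange a b (a ^ n) (b ^ n))
    where
    interchange : ∀ a b c d → a * b * (c * d) ≡ a * c * (b * d)
    interchange = solve-∀

  ^-pair : ∀ a b c m → a * b ≡ c → a ^ suc m * b ^ m ≡ a * c ^ m
  ^-pair a b c m ab≡c = begin
    a * a ^ m * b ^ m   ≡⟨ *-assoc a (a ^ m) (b ^ m) ⟩
    a * (a ^ m * b ^ m) ≡⟨ cong (a *_) (^-distrib-* a b m) ⟨
    a * (a * b) ^ m     ≡⟨ cong (λ v → a * v ^ m) ab≡c ⟩
    a * c ^ m           ∎
    where open ≡-Reasoning

  -- Both halves of 2P carry (q² − 1)^m, since (1 + q)(q − 1) = (1 − q)(−q − 1) = q² − 1.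
  PClrD-closedForm : ∀ m q → PClrD (suc m) q (+ 1) (- + 1) ≡ - ((q ^ 2 - + 1) ^ m)
  PClrD-closedForm m q = *-cancelˡ-≡ (+ 2) _ _ (begin
    + 2 * PClrD (suc m) q (+ 1) (- + 1)
      ≡⟨ twice-PClrD (suc m) q ⟩
    (+ 1 + q) ^ suc m * signedExcSumᶠ (suc m) q + (+ 1 - q) ^ suc m * signedExcSumᶠ (suc m) (- q)
      ≡⟨ cong₂ (λ a b → (+ 1 + q) ^ suc m * a + (+ 1 - q) ^ suc m * b)
               (trans (signedExcSumᶠ≡signedExcSum (suc m) q) (signedExcSum-closedForm m q))
               (trans (signedExcSumᶠ≡signedExcSum (suc m) (- q)) (signedExcSum-closedForm m (- q))) ⟩
    (+ 1 + q) ^ suc m * - (q - + 1) ^ m + (+ 1 - q) ^ suc m * - (- q - + 1) ^ m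
      ≡⟨ pull-neg ((+ 1 + q) ^ suc m) ((q - + 1) ^ m) ((+ 1 - q) ^ suc m) ((- q - + 1) ^ m) ⟩
    - ((+ 1 + q) ^ suc m * (q - + 1) ^ m + (+ 1 - q) ^ suc m * (- q - + 1) ^ m)
      ≡⟨ cong₂ (λ a b → - (a + b)) (^-pair (+ 1 + q) (q - + 1) (q ^ 2 - + 1) m plus)
                                    (^-pair (+ 1 - q) (- q - + 1) (q ^ 2 - + 1) m minus) ⟩
    - ((+ 1 + q) * (q ^ 2 - + 1) ^ m + (+ 1 - q) * (q ^ 2 - + 1) ^ m)
      ≡⟨ collect q ((q ^ 2 - + 1) ^ m) ⟩
    + 2 * - ((q ^ 2 - + 1) ^ m) ∎)
    where
    open ≡-Reasoning
    pull-neg : ∀ a b c d → a * - b + c * - d ≡ - (a * b + c * d)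
    pull-neg = solve-∀
    collect : ∀ q e → - ((+ 1 + q) * e + (+ 1 - q) * e) ≡ + 2 * - e
    collect = solve-∀
    q²≡q*q : q ^ 2 ≡ q * q
    q²≡q*q = cong (q *_) (*-identityʳ q)
    plus-square : ∀ q → (+ 1 + q) * (q - + 1) ≡ q * q - + 1
    plus-square = solve-∀
    minus-square : ∀ q → (+ 1 - q) * (- q - + 1) ≡ q * q - + 1
    minus-square = solve-∀
    plus : (+ 1 + q) * (q - + 1) ≡ q ^ 2 - + 1
    plus = trans (plus-square q) (cong (_- + 1) (sym q²≡q*q))
    minus : (+ 1 - q) * (- q - + 1) ≡ q ^ 2 - + 1
    minus = trans (minus-square q) (cong (_- + 1) (sym q²≡q*q))

open import Defs
open import Data.Nat using (ℕ; _≤_; _∸_; suc; zero; s≤s)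
open import Data.Integer using (ℤ; _+_; _-_; _*_; _^_; -_; +_)
open import Data.Integer.Properties using (neg-distribʳ-*)
open import Data.Product using (_×_; _,_)
open import Relation.Binary.PropositionalEquality using (_≡_; trans; sym; cong)
open ClosedForm using (PClrD-closedForm)

theorem3 : ((n : ℕ) → 2 ≤ n → (q : ℤ) →
    PClrD n q (+ 1) (- + 1) ≡ (q ^ 2 - + 1) * PClrD (n ∸ 1) q (+ 1) (- + 1))
    × ((n : ℕ) → 1 ≤ n → (q : ℤ) →
    PClrD n q (+ 1) (- + 1) ≡ - ((q ^ 2 - + 1) ^ (n ∸ 1)))
theorem3 = recurrence , closedForm
  where
  closedForm : (n : ℕ) → 1 ≤ n → (q : ℤ) → PClrD n q (+ 1) (- + 1) ≡ - ((q ^ 2 - + 1) ^ (n ∸ 1))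
  closedForm (suc m) _ q = PClrD-closedForm m q
  recurrence : (n : ℕ) → 2 ≤ n → (q : ℤ) →
               PClrD n q (+ 1) (- + 1) ≡ (q ^ 2 - + 1) * PClrD (n ∸ 1) q (+ 1) (- + 1)
  recurrence (suc zero) (s≤s ()) q
  recurrence (suc (suc m)) _ q =
    trans (PClrD-closedForm (suc m) q)
          (trans (neg-distribʳ-* (q ^ 2 - + 1) ((q ^ 2 - + 1) ^ m))
                 (cong ((q ^ 2 - + 1) *_) (sym (PClrD-closedForm m q))))
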